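{- Let $n\ge 1$ and $h\ge n$ be integers. In the $h$-RO-SP with $n$ online candidates, Algorithm 3 (which for $h\ge n$ has $q=0$ and operates as follows: at each round $\ell$, with $T_{\ell-1}=H\cup\{c_1,\dots,c_{\ell-1}\}$, draw a subset $X_\ell\subseteq T_{\ell-1}$ of cardinality $n-1$ uniformly at random, and accept $c_\ell$ and terminate iff $c_\ell>\max X_\ell$) is $\left(1-\left(1-\frac1n\right)^n\right)$-competitive.
   Context: The random-order secretary problem with a sample of size $h$ ($h$-RO-SP), for integers $n\ge 1$, $h\ge 0$: an adversary picks a set $C$ of $n+h$ candidates with values in $\mathbb{R}_{\ge 0}$ (totally ordered by value, ties broken by a fixed consistent tie-breaker). A subset $H\subseteq C$ of cardinality $h$ (history set) is drawn uniformly at random and given to the online player upfront (together with $n$); the candidates of $O=C\setminus H$ are then presented one by one in a uniformly random order $c_1,\dots,c_n$; after each arrival the player must irrevocably accept or reject it, and accepting terminates. $\mathrm{ALG}$ is the value of the accepted candidate (0 if none), $\mathrm{OPT}=\max O$; an algorithm is $c$-competitive if $\mathbb{E}[\mathrm{ALG}]\ge c\,\mathbb{E}[\mathrm{OPT}]$ for every $C$, expectation over $H$, the random order, and the algorithm's randomness.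
   Formalization: The candidates' values are nonnegative rationals instead of elements of $\mathbb{R}_{\ge 0}$, and ties between equal values are broken by one fixed order of the candidates. -}

module Defs where

open import Data.Bool using (Bool; true; false; _∧_; _∨_; if_then_else_)
open import Data.Nat as ℕ using (ℕ; zero; suc)
open import Data.Fin using (Fin; toℕ)
open import Data.List using (List; []; _∷_; _++_; [_]; map; concatMap; foldr; length; take; drop; filterᵇ)
open import Data.Rational using (ℚ; 0ℚ; 1ℚ; _+_; _*_; _-_; _/_; _⊔_)
open import Data.Rational.Properties using (_<?_; _≟_)
open import Data.Integer using (+_)
open import Relation.Nullary using (does)

inserts : {A : Set} → A → List A → List (List A)
inserts x []       = (x ∷ []) ∷ []
inserts x (y ∷ ys) = (x ∷ y ∷ ys) ∷ map (y ∷_) (inserts x ys)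

perms : {A : Set} → List A → List (List A)
perms []       = [] ∷ []
perms (x ∷ xs) = concatMap (inserts x) (perms xs)

choose : {A : Set} → ℕ → List A → List (List A)
choose zero    xs       = [] ∷ []
choose (suc k) []       = []
choose (suc k) (x ∷ xs) = map (x ∷_) (choose k xs) ++ choose (suc k) xs

-- a / b as a rational, with the convention a / 0 = 0
ratio : ℕ → ℕ → ℚ
ratio a zero    = 0ℚ
ratio a (suc b) = (+ a) / suc b

-- average of a list of rationals (0 for the empty list)
average : List ℚ → ℚ
average xs = foldr _+_ 0ℚ xs * ratio 1 (length xs)

allᵇ : {A : Set} → (A → Bool) → List A → Bool
allᵇ p []       = true
allᵇ p (x ∷ xs) = p x ∧ allᵇ p xs

_^ℚ_ : ℚ → ℕ → ℚ
p ^ℚ zero  = 1ℚ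
p ^ℚ suc k = p * (p ^ℚ k)

-- The candidate set C is indexed by Fin (n + h); the
-- adversary's choice is a value function  v : Fin (n + h) → ℚ  (values ≥ 0).
-- Candidates are totally ordered by value, ties broken by the index.

module _ {N : ℕ} (v : Fin N → ℚ) where

  _≺ᵇ_ : Fin N → Fin N → Bool
  a ≺ᵇ b = does (v a <? v b) ∨ (does (v a ≟ v b) ∧ (toℕ a ℕ.<ᵇ toℕ b))

  -- probability that Algorithm 3 (q = 0) accepts candidate c at a round
  -- where the set of already seen candidates is T: X is a uniformly
  -- random (k)-subset of T (k = n - 1), and c is accepted iff c > max X
  -- (with max ∅ = -∞, i.e. every element of X is below c).
  acceptProb : ℕ → List (Fin N) → Fin N → ℚ
  acceptProb k T c =
    ratio (length (filterᵇ (λ X → allᵇ (λ x → x ≺ᵇ c) X) (choose k T)))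
          (length (choose k T))

  -- expected value obtained by Algorithm 3 (q = 0, sample size k = n - 1),
  -- given the seen set T so far and the remaining online sequence,
  -- expectation over the algorithm's independent random draws X_ℓ.
  algValue : ℕ → List (Fin N) → List (Fin N) → ℚ
  algValue k T []       = 0ℚ
  algValue k T (c ∷ cs) =
    acceptProb k T c * v c + (1ℚ - acceptProb k T c) * algValue k (T ++ [ c ]) cs

  optValue : List (Fin N) → ℚ
  optValue cs = foldr _⊔_ 0ℚ (map v cs)

open import Data.List using (allFin)

-- A uniformly random ordering π of the whole candidate set C = Fin (n + h):
-- its first h entries form the uniformly random history set H, and the
-- remaining n entries are the online candidates in uniformly random order.
orderings : (n h : ℕ) → List (List (Fin (n ℕ.+ h)))
orderings n h = perms (allFin (n ℕ.+ h))

expectedALG : (n h : ℕ) → (Fin (n ℕ.+ h) → ℚ) → ℚ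
expectedALG n h v =
  average (map (λ π → algValue v (n ℕ.∸ 1) (take h π) (drop h π)) (orderings n h))

expectedOPT : (n h : ℕ) → (Fin (n ℕ.+ h) → ℚ) → ℚ
expectedOPT n h v = average (map (λ π → optValue v (drop h π)) (orderings n h))

ratioBound : ℕ → ℚ
ratioBound n = 1ℚ - (1ℚ - ratio 1 n) ^ℚ n

-- All expectations are computed exactly, as sums over the orderings π of the
-- candidates (the first h entries of π form the history, the rest is the online
-- sequence), by induction on the number t of online positions, splitting off the
-- last entry of π. With m candidates seen, Algorithm 3 accepts a candidate of rank r
-- among them with probability C(r, n-1) / C(m, n-1). The ranks of m + 1 distinct
-- candidates among the others are 0, ..., m, and Σ_{r ≤ m} C(r, n-1) = C(m+1, n),
-- so each round is survived with probability 1 - 1/n whatever happened before: the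
-- algorithm is still running after t rounds with probability β^t, β = 1 - 1/n.
-- The same decomposition gives E[ALG] = (1 - β^t) M, where M is the expected
-- maximum of a uniformly random n-subset of all candidates; for t = n the online
-- set is such a subset, so E[OPT] = M and E[ALG] = (1 - (1 - 1/n)^n) E[OPT].

module Submission where

open import Defs
open import Data.Bool using (Bool; true; false; T; T?; if_then_else_; _∧_)
open import Data.Fin as Fin using (Fin; toℕ)
open import Data.List using (List; []; _∷_; _++_; [_]; map; concatMap; foldr; length; filterᵇ; take; drop)
open import Data.List.Relation.Unary.All as All using (All; []; _∷_)
open import Data.Nat as ℕ using (ℕ; zero; suc; _≤_; _<_; z≤n; s≤s)
import Data.Nat.Properties as ℕₚ
open import Data.Product using (_×_; _,_; proj₁; proj₂)
open import Data.Rational using (ℚ)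
open import Function using (_∘_; id)
open import Relation.Binary.PropositionalEquality hiding ([_])

module BinomialIdentities where

  open import Data.Nat using (_+_; _*_; _∸_; _!; _>_; NonZero)
  open import Data.Nat.Properties
  open import Data.Nat.Combinatorics
  open import Data.Nat.DivMod using (_/_; m/n*n≡m)
  open import Data.Nat.Tactic.RingSolver using (solve-∀)
  open import Algebra.Properties.CommutativeSemigroup *-commutativeSemigroup using (x∙yz≈y∙xz)
  open import Relation.Nullary using (yes; no)
  open ≡-Reasoning

  pascal : ∀ n k → suc n C suc k ≡ n C k + n C suc k
  pascal n k = sym (nCk+nC[k+1]≡[n+1]C[k+1] n k)

  nCk>0 : ∀ {n k} → k ≤ n → n C k > 0
  nCk>0 {k = zero} _ = s≤s z≤n
  nCk>0 {suc n} {suc k} (s≤s k≤n) =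
    subst (_> 0) (sym (pascal n k)) (<-≤-trans (nCk>0 k≤n) (m≤m+n _ _))

  [1+k]*[1+n]C[1+k]≡[1+n]*nCk : ∀ n k → suc k * (suc n C suc k) ≡ suc n * (n C k)
  [1+k]*[1+n]C[1+k]≡[1+n]*nCk zero    zero    = refl
  [1+k]*[1+n]C[1+k]≡[1+n]*nCk zero    (suc k) = *-zeroʳ (2 + k)
  [1+k]*[1+n]C[1+k]≡[1+n]*nCk (suc n) zero    =
    trans (*-identityˡ _) (trans (nC1≡n (2 + n)) (sym (*-identityʳ (2 + n))))
  [1+k]*[1+n]C[1+k]≡[1+n]*nCk (suc n) (suc k) = begin
    (2 + k) * (suc (suc n) C (2 + k))
      ≡⟨ cong ((2 + k) *_) expand ⟩
    (2 + k) * ((a + b) + c)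
      ≡⟨ regroup a b c k ⟩
    (a + b) + (1 + k) * (a + b) + (2 + k) * c
      ≡⟨ cong₂ (λ x y → (a + b) + x + y) (trans (cong (suc k *_) (sym (pascal n k))) ([1+k]*[1+n]C[1+k]≡[1+n]*nCk n k)) ([1+k]*[1+n]C[1+k]≡[1+n]*nCk n (suc k)) ⟩
    (a + b) + (1 + n) * a + (1 + n) * b
      ≡⟨ collect a b n ⟩
    (2 + n) * (a + b)
      ≡⟨ cong ((2 + n) *_) (sym (pascal n k)) ⟩
    (2 + n) * (suc n C suc k)
      ∎
    where
    a b c : ℕ
    a = n C k
    b = n C suc k
    c = suc n C (2 + k)
    expand : suc (suc n) C (2 + k) ≡ (a + b) + c
    expand = trans (pascal (suc n) (suc k)) (cong (_+ c) (pascal n k))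
    regroup : ∀ a b c k → (2 + k) * ((a + b) + c) ≡ (a + b) + (1 + k) * (a + b) + (2 + k) * c
    regroup = solve-∀
    collect : ∀ a b n → (a + b) + (1 + n) * a + (1 + n) * b ≡ (2 + n) * (a + b)
    collect = solve-∀

  [n∸k]*nCk≡[1+k]*nC[1+k] : ∀ n k → (n ∸ k) * (n C k) ≡ suc k * (n C suc k)
  [n∸k]*nCk≡[1+k]*nC[1+k] n k with k ≤? n
  ... | no k≰n = begin
    (n ∸ k) * (n C k)
      ≡⟨ cong ((n ∸ k) *_) (k>n⇒nCk≡0 (≰⇒> k≰n)) ⟩
    (n ∸ k) * 0
      ≡⟨ *-zeroʳ (n ∸ k) ⟩
    0
      ≡⟨ sym (*-zeroʳ (suc k)) ⟩
    suc k * 0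
      ≡⟨ cong (suc k *_) (sym (k>n⇒nCk≡0 (m<n⇒m<1+n (≰⇒> k≰n)))) ⟩
    suc k * (n C suc k) ∎
  ... | yes k≤n = +-cancelˡ-≡ (suc k * (n C k)) _ _ (begin
    suc k * (n C k) + (n ∸ k) * (n C k)
      ≡⟨ sym (*-distribʳ-+ (n C k) (suc k) (n ∸ k)) ⟩
    (suc k + (n ∸ k)) * (n C k)
      ≡⟨ cong (λ m → suc m * (n C k)) (m+[n∸m]≡n k≤n) ⟩
    suc n * (n C k)
      ≡⟨ sym ([1+k]*[1+n]C[1+k]≡[1+n]*nCk n k) ⟩
    suc k * (suc n C suc k)
      ≡⟨ cong (suc k *_) (pascal n k) ⟩
    suc k * (n C k + n C suc k)
      ≡⟨ *-distribˡ-+ (suc k) (n C k) (n C suc k) ⟩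
    suc k * (n C k) + suc k * (n C suc k) ∎)

  n*[n∸1]Ck≡[1+k]*nC[1+k] : ∀ n k → n * ((n ∸ 1) C k) ≡ suc k * (n C suc k)
  n*[n∸1]Ck≡[1+k]*nC[1+k] zero    k = sym (*-zeroʳ (suc k))
  n*[n∸1]Ck≡[1+k]*nC[1+k] (suc n) k = sym ([1+k]*[1+n]C[1+k]≡[1+n]*nCk n k)

  -- Removing one element from a set of size m changes the rank r of another element
  -- to r - 1 in r ways and keeps it in the other m - 1 - r ways.
  deletion-identity : ∀ {r m} k → r < m →
    r * ((r ∸ 1) C k) + (m ∸ suc r) * (r C k) ≡ (m ∸ suc k) * (r C k)
  deletion-identity {r} {m} k r<m = begin
    r * ((r ∸ 1) C k) + (m ∸ suc r) * (r C k)
      ≡⟨ cong (_+ (m ∸ suc r) * (r C k)) (trans (n*[n∸1]Ck≡[1+k]*nC[1+k] r k) (sym ([n∸k]*nCk≡[1+k]*nC[1+k] r k))) ⟩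
    (r ∸ k) * (r C k) + (m ∸ suc r) * (r C k)
      ≡⟨ sym (*-distribʳ-+ (r C k) (r ∸ k) (m ∸ suc r)) ⟩
    ((r ∸ k) + (m ∸ suc r)) * (r C k)
      ≡⟨ factor ⟩
    (m ∸ suc k) * (r C k)
      ∎
    where
    factor : ((r ∸ k) + (m ∸ suc r)) * (r C k) ≡ (m ∸ suc k) * (r C k)
    factor with k ≤? r
    ... | yes k≤r = cong (_* (r C k)) (difference k≤r r<m)
      where
      difference : ∀ {k r m} → k ≤ r → r < m → (r ∸ k) + (m ∸ suc r) ≡ m ∸ suc k
      difference {k} k≤r r<m with m≤n⇒∃[o]m+o≡n k≤r | m≤n⇒∃[o]m+o≡n r<m
      ... | e , refl | d , refl = begin
        (k + e ∸ k) + (suc (k + e) + d ∸ suc (k + e))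
          ≡⟨ cong₂ _+_ (m+n∸m≡n k e) (m+n∸m≡n (suc (k + e)) d) ⟩
        e + d
          ≡⟨ sym (m+n∸m≡n k (e + d)) ⟩
        k + (e + d) ∸ k
          ≡⟨ cong (_∸ k) (sym (+-assoc k e d)) ⟩
        suc (k + e + d) ∸ suc k
          ∎
    ... | no k≰r = begin
      ((r ∸ k) + (m ∸ suc r)) * (r C k)
        ≡⟨ cong (((r ∸ k) + (m ∸ suc r)) *_) r<k⇒rCk≡0 ⟩
      ((r ∸ k) + (m ∸ suc r)) * 0
        ≡⟨ *-zeroʳ ((r ∸ k) + (m ∸ suc r)) ⟩
      0
        ≡⟨ sym (*-zeroʳ (m ∸ suc k)) ⟩
      (m ∸ suc k) * 0
        ≡⟨ cong ((m ∸ suc k) *_) (sym r<k⇒rCk≡0) ⟩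
      (m ∸ suc k) * (r C k)
        ∎
      where
      r<k⇒rCk≡0 : r C k ≡ 0
      r<k⇒rCk≡0 = k>n⇒nCk≡0 (≰⇒> k≰r)

  [n∸k]*[1+n]C[1+k]≡[1+n]*nC[1+k] : ∀ n k → (n ∸ k) * (suc n C suc k) ≡ suc n * (n C suc k)
  [n∸k]*[1+n]C[1+k]≡[1+n]*nC[1+k] n k = *-cancelˡ-≡ _ _ (suc k) (begin
    suc k * ((n ∸ k) * (suc n C suc k))
      ≡⟨ x∙yz≈y∙xz (suc k) (n ∸ k) _ ⟩
    (n ∸ k) * (suc k * (suc n C suc k))
      ≡⟨ cong ((n ∸ k) *_) ([1+k]*[1+n]C[1+k]≡[1+n]*nCk n k) ⟩
    (n ∸ k) * (suc n * (n C k))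
      ≡⟨ x∙yz≈y∙xz (n ∸ k) (suc n) _ ⟩
    suc n * ((n ∸ k) * (n C k))
      ≡⟨ cong (suc n *_) ([n∸k]*nCk≡[1+k]*nC[1+k] n k) ⟩
    suc n * (suc k * (n C suc k))
      ≡⟨ x∙yz≈y∙xz (suc n) (suc k) _ ⟩
    suc k * (suc n * (n C suc k))
      ∎)

  falling : ℕ → ℕ → ℕ
  falling n zero    = 1
  falling n (suc k) = n * falling (n ∸ 1) k

  r*[t*falling[r∸1][t∸1]]+falling≡[1+t]*falling : ∀ r t →
    r * (t * falling (r ∸ 1) (t ∸ 1)) + falling r t ≡ suc t * falling r t
  r*[t*falling[r∸1][t∸1]]+falling≡[1+t]*falling r zero    = cong (_+ 1) (*-zeroʳ r)
  r*[t*falling[r∸1][t∸1]]+falling≡[1+t]*falling r (suc t) = regroup r t (falling (r ∸ 1) t)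
    where
    regroup : ∀ r t f → r * (suc t * f) + r * f ≡ (2 + t) * (r * f)
    regroup = solve-∀

  [k+h]Ck*[k!*h!]≡[k+h]! : ∀ k h → ((k + h) C k) * (k ! * h !) ≡ (k + h) !
  [k+h]Ck*[k!*h!]≡[k+h]! k h = subst (λ d → ((k + h) C k) * (k ! * d !) ≡ (k + h) !) (m+n∸m≡n k h) (begin
    ((k + h) C k) * (k ! * (k + h ∸ k) !)
      ≡⟨ cong (_* (k ! * (k + h ∸ k) !)) (nCk≡n!/k![n-k]! k≤k+h) ⟩
    (k + h) ! / (k ! * (k + h ∸ k) !) * (k ! * (k + h ∸ k) !)
      ≡⟨ m/n*n≡m (k![n∸k]!∣n! k≤k+h) ⟩
    (k + h) !
      ∎)
    where
    k≤k+h : k ≤ k + h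
    k≤k+h = m≤m+n k h
    instance
      k!*[k+h∸k]!≢0 : NonZero (k ! * (k + h ∸ k) !)
      k!*[k+h∸k]!≢0 = k !* (k + h ∸ k) !≢0

  falling≡k!*nCk : ∀ n k → falling n k ≡ k ! * (n C k)
  falling≡k!*nCk n zero    = refl
  falling≡k!*nCk n (suc k) = begin
    n * falling (n ∸ 1) k
      ≡⟨ cong (n *_) (falling≡k!*nCk (n ∸ 1) k) ⟩
    n * (k ! * ((n ∸ 1) C k))
      ≡⟨ x∙yz≈y∙xz n (k !) _ ⟩
    k ! * (n * ((n ∸ 1) C k))
      ≡⟨ cong (k ! *_) (n*[n∸1]Ck≡[1+k]*nC[1+k] n k) ⟩
    k ! * (suc k * (n C suc k))
      ≡⟨ sym (*-assoc (k !) (suc k) _) ⟩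
    k ! * suc k * (n C suc k)
      ≡⟨ cong (_* (n C suc k)) (*-comm (k !) (suc k)) ⟩
    suc k ! * (n C suc k)
      ∎

open BinomialIdentities

module NaturalsInℚ where

  open import Data.Rational using (0ℚ; 1ℚ; _+_; _*_; toℚᵘ)
  open import Data.Rational.Properties
  open import Data.Rational.Unnormalised as ℚᵘ using (mkℚᵘ; *≡*; _≃_)
  import Data.Rational.Unnormalised.Properties as ℚᵘₚ
  import Data.Integer as ℤ
  import Data.Integer.Properties as ℤₚ
  open import Data.Integer.Tactic.RingSolver using (solve-∀)
  open import Tactic.RingSolver using () renaming (solve-∀ to solve-∀ℚ)
  open import Tactic.RingSolver.Core.AlmostCommutativeRing using (AlmostCommutativeRing; fromCommutativeRing)
  open import Relation.Nullary.Decidable.Core using (dec⇒maybe)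
  open import Level using (0ℓ)

  ℚ-ring : AlmostCommutativeRing 0ℓ 0ℓ
  ℚ-ring = fromCommutativeRing +-*-commutativeRing (λ x → dec⇒maybe (0ℚ ≟ x))

  fromℕ : ℕ → ℚ
  fromℕ n = ratio n 1

  private
    ratio-≃ : ∀ a d → toℚᵘ (ratio a (suc d)) ≃ mkℚᵘ (ℤ.+ a) d
    ratio-≃ a d = toℚᵘ-fromℚᵘ (mkℚᵘ (ℤ.+ a) d)

  fromℕ-+ : ∀ m n → fromℕ (m ℕ.+ n) ≡ fromℕ m + fromℕ n
  fromℕ-+ m n = toℚᵘ-injective (begin
    toℚᵘ (fromℕ (m ℕ.+ n))
      ≈⟨ ratio-≃ (m ℕ.+ n) 0 ⟩
    mkℚᵘ (ℤ.+ (m ℕ.+ n)) 0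
      ≈⟨ *≡* (trans (cong (ℤ._* (ℤ.+ 1 ℤ.* ℤ.+ 1)) (ℤₚ.pos-+ m n)) (identity (ℤ.+ m) (ℤ.+ n))) ⟩
    mkℚᵘ (ℤ.+ m) 0 ℚᵘ.+ mkℚᵘ (ℤ.+ n) 0
      ≈⟨ ℚᵘₚ.+-cong (ratio-≃ m 0) (ratio-≃ n 0) ⟨
    toℚᵘ (fromℕ m) ℚᵘ.+ toℚᵘ (fromℕ n)
      ≈⟨ toℚᵘ-homo-+ (fromℕ m) (fromℕ n) ⟨
    toℚᵘ (fromℕ m + fromℕ n)
      ∎)
    where
    open ℚᵘₚ.≃-Reasoning
    identity : ∀ x y → (x ℤ.+ y) ℤ.* (ℤ.+ 1 ℤ.* ℤ.+ 1) ≡ (x ℤ.* ℤ.+ 1 ℤ.+ y ℤ.* ℤ.+ 1) ℤ.* ℤ.+ 1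
    identity = solve-∀

  fromℕ-* : ∀ m n → fromℕ (m ℕ.* n) ≡ fromℕ m * fromℕ n
  fromℕ-* m n = toℚᵘ-injective (begin
    toℚᵘ (fromℕ (m ℕ.* n))
      ≈⟨ ratio-≃ (m ℕ.* n) 0 ⟩
    mkℚᵘ (ℤ.+ (m ℕ.* n)) 0
      ≈⟨ *≡* (trans (cong (ℤ._* (ℤ.+ 1 ℤ.* ℤ.+ 1)) (ℤₚ.pos-* m n)) (identity (ℤ.+ m) (ℤ.+ n))) ⟩
    mkℚᵘ (ℤ.+ m) 0 ℚᵘ.* mkℚᵘ (ℤ.+ n) 0
      ≈⟨ ℚᵘₚ.*-cong (ratio-≃ m 0) (ratio-≃ n 0) ⟨
    toℚᵘ (fromℕ m) ℚᵘ.* toℚᵘ (fromℕ n)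
      ≈⟨ toℚᵘ-homo-* (fromℕ m) (fromℕ n) ⟨
    toℚᵘ (fromℕ m * fromℕ n)
      ∎)
    where
    open ℚᵘₚ.≃-Reasoning
    identity : ∀ x y → (x ℤ.* y) ℤ.* (ℤ.+ 1 ℤ.* ℤ.+ 1) ≡ (x ℤ.* y) ℤ.* ℤ.+ 1
    identity = solve-∀

  ratio≡fromℕ*ratio1 : ∀ a d → ratio a d ≡ fromℕ a * ratio 1 d
  ratio≡fromℕ*ratio1 a zero    = sym (*-zeroʳ (fromℕ a))
  ratio≡fromℕ*ratio1 a (suc d) = toℚᵘ-injective (begin
    toℚᵘ (ratio a (suc d))
      ≈⟨ ratio-≃ a d ⟩
    mkℚᵘ (ℤ.+ a) d
      ≈⟨ *≡* (identity (ℤ.+ a) (ℤ.+ suc d)) ⟩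
    mkℚᵘ (ℤ.+ a) 0 ℚᵘ.* mkℚᵘ (ℤ.+ 1) d
      ≈⟨ ℚᵘₚ.*-cong (ratio-≃ a 0) (ratio-≃ 1 d) ⟨
    toℚᵘ (fromℕ a) ℚᵘ.* toℚᵘ (ratio 1 (suc d))
      ≈⟨ toℚᵘ-homo-* (fromℕ a) (ratio 1 (suc d)) ⟨
    toℚᵘ (fromℕ a * ratio 1 (suc d))
      ∎)
    where
    open ℚᵘₚ.≃-Reasoning
    identity : ∀ x y → x ℤ.* (ℤ.+ 1 ℤ.* y) ≡ (x ℤ.* ℤ.+ 1) ℤ.* y
    identity = solve-∀

  fromℕ*ratio1≡1 : ∀ d .{{_ : ℕ.NonZero d}} → fromℕ d * ratio 1 d ≡ 1ℚ
  fromℕ*ratio1≡1 (suc d) = trans (sym (ratio≡fromℕ*ratio1 (suc d) (suc d))) (toℚᵘ-injective (begin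
    toℚᵘ (ratio (suc d) (suc d))
      ≈⟨ ratio-≃ (suc d) d ⟩
    mkℚᵘ (ℤ.+ suc d) d
      ≈⟨ *≡* (ℤₚ.*-comm (ℤ.+ suc d) (ℤ.+ 1)) ⟩
    ℚᵘ.1ℚᵘ
      ∎))
    where open ℚᵘₚ.≃-Reasoning

  ratio1-cross : ∀ {a b d e} .{{_ : ℕ.NonZero d}} .{{_ : ℕ.NonZero e}} →
    a ℕ.* e ≡ b ℕ.* d → fromℕ a * ratio 1 d ≡ fromℕ b * ratio 1 e
  ratio1-cross {a} {b} {d} {e} ae≡bd = begin
    fromℕ a * ratio 1 d
      ≡⟨ sym (*-identityʳ _) ⟩
    fromℕ a * ratio 1 d * 1ℚ
      ≡⟨ cong (fromℕ a * ratio 1 d *_) (sym (fromℕ*ratio1≡1 e)) ⟩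
    fromℕ a * ratio 1 d * (fromℕ e * ratio 1 e)
      ≡⟨ regroup (fromℕ a) (ratio 1 d) (fromℕ e) (ratio 1 e) ⟩
    (fromℕ a * fromℕ e) * (ratio 1 d * ratio 1 e)
      ≡⟨ cong (_* (ratio 1 d * ratio 1 e)) (trans (sym (fromℕ-* a e)) (trans (cong fromℕ ae≡bd) (fromℕ-* b d))) ⟩
    (fromℕ b * fromℕ d) * (ratio 1 d * ratio 1 e)
      ≡⟨ regroup′ (fromℕ b) (fromℕ d) (ratio 1 d) (ratio 1 e) ⟩
    fromℕ b * ratio 1 e * (fromℕ d * ratio 1 d)
      ≡⟨ cong (fromℕ b * ratio 1 e *_) (fromℕ*ratio1≡1 d) ⟩
    fromℕ b * ratio 1 e * 1ℚ
      ≡⟨ *-identityʳ _ ⟩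
    fromℕ b * ratio 1 e
      ∎
    where
    open ≡-Reasoning
    regroup : ∀ x y z w → x * y * (z * w) ≡ (x * z) * (y * w)
    regroup = solve-∀ℚ ℚ-ring
    regroup′ : ∀ x y z w → (x * y) * (z * w) ≡ x * w * (y * z)
    regroup′ = solve-∀ℚ ℚ-ring

open NaturalsInℚ

module FiniteSums where

  open import Data.Rational using (0ℚ; 1ℚ; _+_; _*_; _-_)
  open import Data.Rational.Properties
  open import Algebra.Properties.Monoid.Sum +-0-monoid using (sum; sum-init-last; sum-cong-≗)
  open import Algebra.Properties.CommutativeMonoid.Sum +-0-commutativeMonoid using (sum-remove)
  import Data.Fin.Properties as Finₚ
  open import Data.List.Properties using (length-map)
  open import Data.Nat.Combinatorics using (_C_)
  open import Data.Empty using (⊥-elim)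
  open import Relation.Nullary using (yes; no)
  open import Tactic.RingSolver using () renaming (solve-∀ to solve-∀ℚ)

  ∑ : {A : Set} → List A → (A → ℚ) → ℚ
  ∑ []       f = 0ℚ
  ∑ (x ∷ xs) f = f x + ∑ xs f

  syntax ∑ xs (λ x → e) = ∑[ x ∈ xs ] e

  private
    variable
      A B : Set


  ∑-++ : ∀ (xs ys : List A) f → ∑ (xs ++ ys) f ≡ ∑ xs f + ∑ ys f
  ∑-++ []       ys f = sym (+-identityˡ _)
  ∑-++ (x ∷ xs) ys f = trans (cong (f x +_) (∑-++ xs ys f)) (sym (+-assoc (f x) _ _))

  ∑-map : ∀ (g : A → B) xs f → ∑ (map g xs) f ≡ ∑[ x ∈ xs ] f (g x)
  ∑-map g []       f = refl
  ∑-map g (x ∷ xs) f = cong (f (g x) +_) (∑-map g xs f)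

  ∑-concatMap : ∀ (g : A → List B) xs f → ∑ (concatMap g xs) f ≡ ∑[ x ∈ xs ] ∑ (g x) f
  ∑-concatMap g []       f = refl
  ∑-concatMap g (x ∷ xs) f = trans (∑-++ (g x) (concatMap g xs) f) (cong (∑ (g x) f +_) (∑-concatMap g xs f))

  ∑-cong-≗ : ∀ (xs : List A) {f g} → (∀ x → f x ≡ g x) → ∑ xs f ≡ ∑ xs g
  ∑-cong-≗ []       e = refl
  ∑-cong-≗ (x ∷ xs) e = cong₂ _+_ (e x) (∑-cong-≗ xs e)

  ∑-cong-local : ∀ {xs : List A} {f g} → All (λ x → f x ≡ g x) xs → ∑ xs f ≡ ∑ xs g
  ∑-cong-local []       = refl
  ∑-cong-local (e ∷ es) = cong₂ _+_ e (∑-cong-local es)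

  ∑-distrib-+ : ∀ (xs : List A) f g → ∑[ x ∈ xs ] (f x + g x) ≡ ∑ xs f + ∑ xs g
  ∑-distrib-+ []       f g = refl
  ∑-distrib-+ (x ∷ xs) f g = trans (cong (f x + g x +_) (∑-distrib-+ xs f g)) (interchange (f x) (g x) (∑ xs f) (∑ xs g))
    where
    interchange : ∀ a b c d → a + b + (c + d) ≡ a + c + (b + d)
    interchange = solve-∀ℚ ℚ-ring

  ∑-distrib-sub : ∀ (xs : List A) f g → ∑[ x ∈ xs ] (f x - g x) ≡ ∑ xs f - ∑ xs g
  ∑-distrib-sub []       f g = refl
  ∑-distrib-sub (x ∷ xs) f g = trans (cong (f x - g x +_) (∑-distrib-sub xs f g)) (interchange (f x) (g x) (∑ xs f) (∑ xs g))
    where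
    interchange : ∀ a b c d → a - b + (c - d) ≡ a + c - (b + d)
    interchange = solve-∀ℚ ℚ-ring

  ∑-*ˡ : ∀ c (xs : List A) f → ∑[ x ∈ xs ] (c * f x) ≡ c * ∑ xs f
  ∑-*ˡ c []       f = sym (*-zeroʳ c)
  ∑-*ˡ c (x ∷ xs) f = trans (cong (c * f x +_) (∑-*ˡ c xs f)) (sym (*-distribˡ-+ c (f x) _))

  ∑-*ʳ : ∀ c (xs : List A) f → ∑[ x ∈ xs ] (f x * c) ≡ ∑ xs f * c
  ∑-*ʳ c []       f = sym (*-zeroˡ c)
  ∑-*ʳ c (x ∷ xs) f = trans (cong (f x * c +_) (∑-*ʳ c xs f)) (sym (*-distribʳ-+ c (f x) _))

  ∑-const : ∀ c (xs : List A) → ∑[ x ∈ xs ] c ≡ fromℕ (length xs) * c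
  ∑-const c []       = sym (*-zeroˡ c)
  ∑-const c (x ∷ xs) = begin
    c + ∑[ x ∈ xs ] c
      ≡⟨ cong (c +_) (∑-const c xs) ⟩
    c + fromℕ (length xs) * c
      ≡⟨ distrib c (fromℕ (length xs)) ⟩
    (1ℚ + fromℕ (length xs)) * c
      ≡⟨ cong (_* c) (sym (fromℕ-+ 1 (length xs))) ⟩
    fromℕ (suc (length xs)) * c
      ∎
    where
    open ≡-Reasoning
    distrib : ∀ c n → c + n * c ≡ (1ℚ + n) * c
    distrib = solve-∀ℚ ℚ-ring

  𝟙 : Bool → ℚ
  𝟙 true  = 1ℚ
  𝟙 false = 0ℚ

  𝟙-∧ : ∀ a b → 𝟙 (a ∧ b) ≡ 𝟙 a * 𝟙 b
  𝟙-∧ true  b = sym (*-identityˡ (𝟙 b))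
  𝟙-∧ false b = sym (*-zeroˡ (𝟙 b))

  𝟙*≡if : ∀ b q → 𝟙 b * q ≡ (if b then q else 0ℚ)
  𝟙*≡if true  q = *-identityˡ q
  𝟙*≡if false q = *-zeroˡ q

  foldr-+-map : ∀ (f : A → ℚ) xs → foldr _+_ 0ℚ (map f xs) ≡ ∑ xs f
  foldr-+-map f []       = refl
  foldr-+-map f (x ∷ xs) = cong (f x +_) (foldr-+-map f xs)

  average-map : ∀ (f : A → ℚ) xs → average (map f xs) ≡ ∑ xs f * ratio 1 (length xs)
  average-map f xs = cong₂ _*_ (foldr-+-map f xs) (cong (ratio 1) (length-map f xs))

  punchInℕ : ℕ → ℕ → ℕ
  punchInℕ a r with a ℕ.≤? r
  ... | yes _ = suc r
  ... | no  _ = r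

  punchInℕ-≤ : ∀ {a r} → a ≤ r → punchInℕ a r ≡ suc r
  punchInℕ-≤ {a} {r} a≤r with a ℕ.≤? r
  ... | yes _   = refl
  ... | no a≰r = ⊥-elim (a≰r a≤r)

  punchInℕ-> : ∀ {a r} → r < a → punchInℕ a r ≡ r
  punchInℕ-> {a} {r} r<a with a ℕ.≤? r
  ... | yes a≤r = ⊥-elim (ℕₚ.<⇒≱ r<a a≤r)
  ... | no _    = refl

  toℕ-punchIn : ∀ {n} (i : Fin (suc n)) (j : Fin n) → toℕ (Fin.punchIn i j) ≡ punchInℕ (toℕ i) (toℕ j)
  toℕ-punchIn i j with toℕ i ℕ.≤? toℕ j
  ... | yes i≤j = punchIn-≤ i j i≤j
    where
    punchIn-≤ : ∀ {n} (i : Fin (suc n)) (j : Fin n) → toℕ i ≤ toℕ j → toℕ (Fin.punchIn i j) ≡ suc (toℕ j)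
    punchIn-≤ Fin.zero    j           _         = refl
    punchIn-≤ (Fin.suc i) (Fin.suc j) (s≤s i≤j) = cong suc (punchIn-≤ i j i≤j)
  ... | no  i≰j = punchIn-> i j (ℕₚ.≰⇒> i≰j)
    where
    punchIn-> : ∀ {n} (i : Fin (suc n)) (j : Fin n) → toℕ j < toℕ i → toℕ (Fin.punchIn i j) ≡ toℕ j
    punchIn-> (Fin.suc i) Fin.zero    _         = refl
    punchIn-> (Fin.suc i) (Fin.suc j) (s≤s j<i) = cong suc (punchIn-> i j j<i)

  sum-punchIn : ∀ (H : ℕ → ℚ) {m a} → a ≤ m →
    H a + sum (λ (j : Fin m) → H (punchInℕ a (toℕ j))) ≡ sum (λ (i : Fin (suc m)) → H (toℕ i))
  sum-punchIn H {m} {a} a≤m = sym (trans (sum-remove {i = i} (H ∘ toℕ)) (cong₂ _+_ (cong H a≡i) (sum-cong-≗ shift)))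
    where
    i : Fin (suc m)
    i = Fin.fromℕ< (s≤s a≤m)
    a≡i : toℕ i ≡ a
    a≡i = Finₚ.toℕ-fromℕ< (s≤s a≤m)
    shift : ∀ j → H (toℕ (Fin.punchIn i j)) ≡ H (punchInℕ a (toℕ j))
    shift j = cong H (trans (toℕ-punchIn i j) (cong (λ b → punchInℕ b (toℕ j)) a≡i))

  sum-C : ∀ m k → sum (λ (i : Fin m) → fromℕ (toℕ i C k)) ≡ fromℕ (m C suc k)
  sum-C zero    k = refl
  sum-C (suc m) k = begin
    sum (λ (i : Fin (suc m)) → fromℕ (toℕ i C k))
      ≡⟨ sum-init-last {m} (λ i → fromℕ (toℕ i C k)) ⟩
    sum (λ (i : Fin m) → fromℕ (toℕ (Fin.inject₁ i) C k)) + fromℕ (toℕ (Fin.fromℕ m) C k)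
      ≡⟨ cong₂ _+_ (sum-cong-≗ {m} (λ i → cong (λ j → fromℕ (j C k)) (Finₚ.toℕ-inject₁ i)))
                   (cong (λ j → fromℕ (j C k)) (Finₚ.toℕ-fromℕ m)) ⟩
    sum (λ (i : Fin m) → fromℕ (toℕ i C k)) + fromℕ (m C k)
      ≡⟨ cong (_+ fromℕ (m C k)) (sum-C m k) ⟩
    fromℕ (m C suc k) + fromℕ (m C k)
      ≡⟨ sym (fromℕ-+ (m C suc k) (m C k)) ⟩
    fromℕ (m C suc k ℕ.+ m C k)
      ≡⟨ cong fromℕ (trans (ℕₚ.+-comm (m C suc k) (m C k)) (sym (pascal m k))) ⟩
    fromℕ (suc m C suc k)
      ∎
    where open ≡-Reasoning

open FiniteSums

module ListCombinatorics where

  open import Data.Rational using (0ℚ; 1ℚ; _+_; _*_)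
  open import Data.Rational.Properties using (+-identityʳ; +-comm; +-assoc; *-assoc; *-identityˡ)
  open import Data.Nat using (_!)
  open import Data.Nat.Combinatorics using (_C_)
  open import Data.Bool.Properties using (∧-identityʳ; ∧-assoc)
  open import Data.Product using (map₂)
  open import Data.List.Properties using (++-assoc; filter-++; length-++; length-map; length-filter)
  open import Data.List.Membership.Propositional using (_∈_)
  open import Data.List.Relation.Unary.Any using (here; there)
  import Data.List.Relation.Unary.All.Properties as All
  open import Data.List.Relation.Binary.Permutation.Propositional using (_↭_; ↭-refl; ↭-trans; prep; swap)
  open import Data.List.Relation.Binary.Permutation.Propositional.Properties using (↭-length)
  open import Data.Empty using (⊥-elim)
  open import Data.Unit using (tt)
  open import Relation.Nullary using (¬_)
  open import Tactic.RingSolver using () renaming (solve-∀ to solve-∀ℚ)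
  open ≡-Reasoning

  private
    variable
      A : Set

  picks : List A → List (A × List A)
  picks []       = []
  picks (x ∷ xs) = (x , xs) ∷ map (map₂ (x ∷_)) (picks xs)

  ∑-picks : ∀ (xs : List A) f → ∑[ p ∈ picks xs ] f (proj₁ p) ≡ ∑ xs f
  ∑-picks []       f = refl
  ∑-picks (x ∷ xs) f = cong (f x +_) (trans (∑-map (map₂ (x ∷_)) (picks xs) (f ∘ proj₁)) (∑-picks xs f))

  picks-↭ : ∀ (xs : List A) → All (λ p → xs ↭ proj₁ p ∷ proj₂ p) (picks xs)
  picks-↭ []       = []
  picks-↭ (x ∷ xs) = ↭-refl ∷ All.map⁺ (All.map (λ {p} xs↭ → ↭-trans (prep x xs↭) (swap x (proj₁ p) ↭-refl)) (picks-↭ xs))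

  inserts-↭ : ∀ (x : A) xs → All (_↭ x ∷ xs) (inserts x xs)
  inserts-↭ x []       = ↭-refl ∷ []
  inserts-↭ x (y ∷ ys) = ↭-refl ∷ All.map⁺ (All.map (λ π↭ → ↭-trans (prep y π↭) (swap y x ↭-refl)) (inserts-↭ x ys))

  perms-↭ : ∀ (xs : List A) → All (_↭ xs) (perms xs)
  perms-↭ []       = ↭-refl ∷ []
  perms-↭ (x ∷ xs) = All.concat⁺ (All.map⁺ (All.map (λ σ↭ → All.map (λ π↭ → ↭-trans π↭ (prep x σ↭)) (inserts-↭ x _)) (perms-↭ xs)))

  length-inserts : ∀ (x : A) xs → length (inserts x xs) ≡ suc (length xs)
  length-inserts x []       = refl
  length-inserts x (y ∷ ys) = cong suc (trans (length-map (y ∷_) (inserts x ys)) (length-inserts x ys))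

  ∑-perms-const : ∀ c (xs : List A) → ∑[ σ ∈ perms xs ] c ≡ fromℕ (length xs !) * c
  ∑-perms-const c []       = trans (+-identityʳ c) (sym (*-identityˡ c))
  ∑-perms-const c (x ∷ xs) = begin
    ∑[ π ∈ concatMap (inserts x) (perms xs) ] c
      ≡⟨ ∑-concatMap (inserts x) (perms xs) (λ _ → c) ⟩
    ∑[ σ ∈ perms xs ] ∑[ π ∈ inserts x σ ] c
      ≡⟨ ∑-cong-local (All.map (λ {σ} σ↭ → trans (∑-const c (inserts x σ))
                                                  (cong (λ n → fromℕ n * c) (trans (length-inserts x σ) (cong suc (↭-length σ↭)))))
                               (perms-↭ xs)) ⟩
    ∑[ σ ∈ perms xs ] (fromℕ (suc (length xs)) * c)
      ≡⟨ ∑-perms-const _ xs ⟩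
    fromℕ (length xs !) * (fromℕ (suc (length xs)) * c)
      ≡⟨ sym (*-assoc (fromℕ (length xs !)) (fromℕ (suc (length xs))) c) ⟩
    fromℕ (length xs !) * fromℕ (suc (length xs)) * c
      ≡⟨ cong (_* c) (trans (sym (fromℕ-* (length xs !) (suc (length xs)))) (cong fromℕ (ℕₚ.*-comm (length xs !) (suc (length xs))))) ⟩
    fromℕ (suc (length xs) !) * c
      ∎

  ∑-inserts-snoc : ∀ (x y : A) σ f →
    ∑ (inserts x (σ ++ [ y ])) f ≡ ∑[ π ∈ inserts x σ ] f (π ++ [ y ]) + f (σ ++ y ∷ x ∷ [])
  ∑-inserts-snoc x y []      f = shuffle (f (x ∷ y ∷ [])) (f (y ∷ x ∷ []))
    where
    shuffle : ∀ a b → a + (b + 0ℚ) ≡ (a + 0ℚ) + b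
    shuffle = solve-∀ℚ ℚ-ring
  ∑-inserts-snoc x y (z ∷ σ) f = begin
    f (x ∷ z ∷ σ ++ [ y ]) + ∑ (map (z ∷_) (inserts x (σ ++ [ y ]))) f
      ≡⟨ cong (f (x ∷ z ∷ σ ++ [ y ]) +_) (trans (∑-map (z ∷_) (inserts x (σ ++ [ y ])) f) (∑-inserts-snoc x y σ (f ∘ (z ∷_)))) ⟩
    f (x ∷ z ∷ σ ++ [ y ]) + (∑[ π ∈ inserts x σ ] f (z ∷ π ++ [ y ]) + f (z ∷ σ ++ y ∷ x ∷ []))
      ≡⟨ sym (+-assoc (f (x ∷ z ∷ σ ++ [ y ])) _ (f (z ∷ σ ++ y ∷ x ∷ []))) ⟩
    f (x ∷ z ∷ σ ++ [ y ]) + ∑[ π ∈ inserts x σ ] f (z ∷ π ++ [ y ]) + f (z ∷ σ ++ y ∷ x ∷ [])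
      ≡⟨ cong (λ s → f (x ∷ z ∷ σ ++ [ y ]) + s + f (z ∷ σ ++ y ∷ x ∷ [])) (sym (∑-map (z ∷_) (inserts x σ) (λ π → f (π ++ [ y ])))) ⟩
    f (x ∷ z ∷ σ ++ [ y ]) + ∑[ π ∈ map (z ∷_) (inserts x σ) ] f (π ++ [ y ]) + f (z ∷ σ ++ y ∷ x ∷ [])
      ∎

  ∑-perms-last : ∀ (x : A) xs f →
    ∑ (perms (x ∷ xs)) f ≡ ∑[ p ∈ picks (x ∷ xs) ] ∑[ σ ∈ perms (proj₂ p) ] f (σ ++ [ proj₁ p ])
  ∑-perms-last x []       f = sym (+-identityʳ _)
  ∑-perms-last {A} x (z ∷ zs) f = begin
    ∑ (concatMap (inserts x) (perms (z ∷ zs))) f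
      ≡⟨ ∑-concatMap (inserts x) (perms (z ∷ zs)) f ⟩
    ∑[ τ ∈ perms (z ∷ zs) ] ∑ (inserts x τ) f
      ≡⟨ ∑-perms-last z zs (λ τ → ∑ (inserts x τ) f) ⟩
    ∑[ p ∈ picks (z ∷ zs) ] ∑[ σ ∈ perms (proj₂ p) ] ∑ (inserts x (σ ++ [ proj₁ p ])) f
      ≡⟨ ∑-cong-≗ (picks (z ∷ zs)) (λ p → trans (∑-cong-≗ (perms (proj₂ p)) (λ σ → ∑-inserts-snoc x (proj₁ p) σ f)) (∑-distrib-+ (perms (proj₂ p)) _ _)) ⟩
    ∑[ p ∈ picks (z ∷ zs) ] (inserted p + appended p)
      ≡⟨ ∑-distrib-+ (picks (z ∷ zs)) inserted appended ⟩
    ∑ (picks (z ∷ zs)) inserted + ∑ (picks (z ∷ zs)) appended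
      ≡⟨ +-comm (∑ (picks (z ∷ zs)) inserted) (∑ (picks (z ∷ zs)) appended) ⟩
    ∑ (picks (z ∷ zs)) appended + ∑ (picks (z ∷ zs)) inserted
      ≡⟨ cong₂ _+_ lastIsX lastBeforeX ⟩
    ∑[ σ ∈ perms (z ∷ zs) ] f (σ ++ [ x ]) + ∑[ p ∈ map (map₂ (x ∷_)) (picks (z ∷ zs)) ] ∑[ σ ∈ perms (proj₂ p) ] f (σ ++ [ proj₁ p ])
      ∎
    where
    inserted appended : A × List A → ℚ
    inserted p = ∑[ σ ∈ perms (proj₂ p) ] ∑[ π ∈ inserts x σ ] f (π ++ [ proj₁ p ])
    appended p = ∑[ σ ∈ perms (proj₂ p) ] f (σ ++ proj₁ p ∷ x ∷ [])
    lastIsX : ∑ (picks (z ∷ zs)) appended ≡ ∑[ σ ∈ perms (z ∷ zs) ] f (σ ++ [ x ])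
    lastIsX = trans (∑-cong-≗ (picks (z ∷ zs)) (λ p → ∑-cong-≗ (perms (proj₂ p)) (λ σ → cong f (sym (++-assoc σ [ proj₁ p ] [ x ])))))
                    (sym (∑-perms-last z zs (λ σ → f (σ ++ [ x ]))))
    lastBeforeX : ∑ (picks (z ∷ zs)) inserted ≡ ∑[ p ∈ map (map₂ (x ∷_)) (picks (z ∷ zs)) ] ∑[ σ ∈ perms (proj₂ p) ] f (σ ++ [ proj₁ p ])
    lastBeforeX = sym (trans (∑-map (map₂ (x ∷_)) (picks (z ∷ zs)) (λ p → ∑[ σ ∈ perms (proj₂ p) ] f (σ ++ [ proj₁ p ])))
                             (∑-cong-≗ (picks (z ∷ zs)) (λ p → ∑-concatMap (inserts x) (perms (proj₂ p)) (λ π → f (π ++ [ proj₁ p ])))))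

  length-filter-all-∷ : ∀ (p : A → Bool) x L →
    length (filterᵇ (allᵇ p) (map (x ∷_) L)) ≡ (if p x then length (filterᵇ (allᵇ p) L) else 0)
  length-filter-all-∷ p x [] with p x
  ... | true  = refl
  ... | false = refl
  length-filter-all-∷ p x (X ∷ L) with p x | allᵇ p X | length-filter-all-∷ p x L
  ... | true  | true  | ih = cong suc ih
  ... | true  | false | ih = ih
  ... | false | _     | ih = ih

  split-++ : ∀ (p : A → Bool) x k xs → length (filterᵇ (allᵇ p) (choose (suc k) (x ∷ xs))) ≡
    length (filterᵇ (allᵇ p) (map (x ∷_) (choose k xs))) ℕ.+ length (filterᵇ (allᵇ p) (choose (suc k) xs))
  split-++ p x k xs = trans (cong length (filter-++ (T? ∘ allᵇ p) (map (x ∷_) (choose k xs)) (choose (suc k) xs)))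
                            (length-++ (filterᵇ (allᵇ p) (map (x ∷_) (choose k xs))))

  length-filter-all-choose : ∀ (p : A → Bool) k xs →
    length (filterᵇ (allᵇ p) (choose k xs)) ≡ length (filterᵇ p xs) C k
  length-filter-all-choose p zero    xs       = refl
  length-filter-all-choose p (suc k) []       = refl
  length-filter-all-choose p (suc k) (x ∷ xs) with p x | length-filter-all-∷ p x (choose k xs)
  ... | true  | e = trans (split-++ p x k xs) (trans (cong₂ ℕ._+_ (trans e (length-filter-all-choose p k xs)) (length-filter-all-choose p (suc k) xs)) (sym (pascal _ k)))
  ... | false | e = trans (split-++ p x k xs) (cong₂ ℕ._+_ e (length-filter-all-choose p (suc k) xs))


  length-choose : ∀ k (xs : List A) → length (choose k xs) ≡ length xs C k
  length-choose zero    xs       = refl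
  length-choose (suc k) []       = refl
  length-choose (suc k) (x ∷ xs) = begin
    length (map (x ∷_) (choose k xs) ++ choose (suc k) xs)
      ≡⟨ length-++ (map (x ∷_) (choose k xs)) ⟩
    length (map (x ∷_) (choose k xs)) ℕ.+ length (choose (suc k) xs)
      ≡⟨ cong₂ ℕ._+_ (trans (length-map (x ∷_) (choose k xs)) (length-choose k xs)) (length-choose (suc k) xs) ⟩
    length xs C k ℕ.+ length xs C suc k
      ≡⟨ sym (pascal (length xs) k) ⟩
    suc (length xs) C suc k
      ∎

  length-filter-mono : ∀ {p q : A → Bool} → (∀ x → T (p x) → T (q x)) →
    ∀ xs → length (filterᵇ p xs) ≤ length (filterᵇ q xs)
  length-filter-mono p⇒q [] = z≤n
  length-filter-mono {p = p} {q} p⇒q (x ∷ xs) with p x | q x | p⇒q x | length-filter-mono p⇒q xs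
  ... | true  | true  | _   | ih = s≤s ih
  ... | true  | false | p⇒q | _  = ⊥-elim (p⇒q tt)
  ... | false | true  | _   | ih = ℕₚ.m≤n⇒m≤1+n ih
  ... | false | false | _   | ih = ih

  length-filter-mono-< : ∀ {p q : A → Bool} → (∀ x → T (p x) → T (q x)) →
    ∀ {x xs} → x ∈ xs → ¬ T (p x) → T (q x) → length (filterᵇ p xs) < length (filterᵇ q xs)
  length-filter-mono-< {p = p} {q} p⇒q {x} {x ∷ xs} (here refl) ¬px qx with p x | q x
  ... | true  | _     = ⊥-elim (¬px tt)
  ... | false | true  = s≤s (length-filter-mono p⇒q xs)
  length-filter-mono-< {p = p} {q} p⇒q {xs = y ∷ xs} (there x∈xs) ¬px qx with p y | q y | p⇒q y | length-filter-mono-< p⇒q x∈xs ¬px qx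
  ... | true  | true  | _   | ih = s≤s ih
  ... | true  | false | p⇒q | _  = ⊥-elim (p⇒q tt)
  ... | false | true  | _   | ih = ℕₚ.m<n⇒m<1+n ih
  ... | false | false | _   | ih = ih

  ∑-if : ∀ (p : A → Bool) xs a b → ∑[ x ∈ xs ] (if p x then a else b) ≡
    fromℕ (length (filterᵇ p xs)) * a + fromℕ (length xs ℕ.∸ length (filterᵇ p xs)) * b
  ∑-if p []       a b = zeros a b
    where
    zeros : ∀ a b → 0ℚ ≡ 0ℚ * a + 0ℚ * b
    zeros = solve-∀ℚ ℚ-ring
  ∑-if p (x ∷ xs) a b with p x | ∑-if p xs a b | length-filter (T? ∘ p) xs
  ... | true  | ih | _ =
    trans (cong (a +_) ih)
          (trans (step a b (fromℕ c) (fromℕ (length xs ℕ.∸ c)))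
                 (cong (λ n → n * a + fromℕ (length xs ℕ.∸ c) * b) (sym (fromℕ-+ 1 c))))
    where
    c : ℕ
    c = length (filterᵇ p xs)
    step : ∀ a b c d → a + (c * a + d * b) ≡ (1ℚ + c) * a + d * b
    step = solve-∀ℚ ℚ-ring
  ... | false | ih | c≤n =
    trans (cong (b +_) ih)
          (trans (step a b (fromℕ c) (fromℕ (length xs ℕ.∸ c)))
                 (cong (λ n → fromℕ c * a + n * b) (trans (sym (fromℕ-+ 1 (length xs ℕ.∸ c))) (cong fromℕ (sym (ℕₚ.+-∸-assoc 1 c≤n))))))
    where
    c : ℕ
    c = length (filterᵇ p xs)
    step : ∀ a b c d → b + (c * a + d * b) ≡ c * a + (1ℚ + d) * b
    step = solve-∀ℚ ℚ-ring

  ∑-picks-swap : ∀ (xs : List A) (F : A → A → ℚ) →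
    ∑[ p ∈ picks xs ] ∑[ y ∈ proj₂ p ] F (proj₁ p) y ≡ ∑[ p ∈ picks xs ] ∑[ x ∈ proj₂ p ] F x (proj₁ p)
  ∑-picks-swap []       F = refl
  ∑-picks-swap {A} (z ∷ zs) F = begin
    ∑ zs (F z) + ∑ (map (map₂ (z ∷_)) (picks zs)) rowSum
      ≡⟨ cong (∑ zs (F z) +_) (trans (∑-map (map₂ (z ∷_)) (picks zs) rowSum) (∑-distrib-+ (picks zs) (λ p → F (proj₁ p) z) rowSum)) ⟩
    ∑ zs (F z) + (∑[ p ∈ picks zs ] F (proj₁ p) z + ∑ (picks zs) rowSum)
      ≡⟨ cong₂ (λ a b → ∑ zs (F z) + (a + b)) (∑-picks zs (λ x → F x z)) (∑-picks-swap zs F) ⟩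
    ∑ zs (F z) + (∑[ x ∈ zs ] F x z + ∑ (picks zs) columnSum)
      ≡⟨ exchange (∑ zs (F z)) (∑[ x ∈ zs ] F x z) (∑ (picks zs) columnSum) ⟩
    ∑[ x ∈ zs ] F x z + (∑ zs (F z) + ∑ (picks zs) columnSum)
      ≡⟨ cong (λ a → ∑[ x ∈ zs ] F x z + (a + ∑ (picks zs) columnSum)) (sym (∑-picks zs (F z))) ⟩
    ∑[ x ∈ zs ] F x z + (∑[ p ∈ picks zs ] F z (proj₁ p) + ∑ (picks zs) columnSum)
      ≡⟨ cong (∑[ x ∈ zs ] F x z +_) (sym (trans (∑-map (map₂ (z ∷_)) (picks zs) columnSum) (∑-distrib-+ (picks zs) (λ p → F z (proj₁ p)) columnSum))) ⟩
    ∑[ x ∈ zs ] F x z + ∑ (map (map₂ (z ∷_)) (picks zs)) columnSum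
      ∎
    where
    rowSum columnSum : A × List A → ℚ
    rowSum p    = ∑[ y ∈ proj₂ p ] F (proj₁ p) y
    columnSum p = ∑[ x ∈ proj₂ p ] F x (proj₁ p)
    exchange : ∀ a b c → a + (b + c) ≡ b + (a + c)
    exchange = solve-∀ℚ ℚ-ring

  take-++ˡ : ∀ n (xs ys : List A) → n ≤ length xs → take n (xs ++ ys) ≡ take n xs
  take-++ˡ zero    xs       ys _         = refl
  take-++ˡ (suc n) (x ∷ xs) ys (s≤s n≤l) = cong (x ∷_) (take-++ˡ n xs ys n≤l)

  drop-++ˡ : ∀ n (xs ys : List A) → n ≤ length xs → drop n (xs ++ ys) ≡ drop n xs ++ ys
  drop-++ˡ zero    xs       ys _         = refl
  drop-++ˡ (suc n) (x ∷ xs) ys (s≤s n≤l) = drop-++ˡ n xs ys n≤l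

  allᵇ-++ : ∀ (p : A → Bool) xs x → allᵇ p (xs ++ [ x ]) ≡ allᵇ p xs ∧ p x
  allᵇ-++ p []       x = ∧-identityʳ (p x)
  allᵇ-++ p (y ∷ xs) x = trans (cong (p y ∧_) (allᵇ-++ p xs x)) (sym (∧-assoc (p y) (allᵇ p xs) (p x)))

open ListCombinatorics

module Candidates {N : ℕ} (v : Fin N → ℚ) where

  open import Data.Rational as ℚ using (0ℚ; 1ℚ; _+_; _*_; _-_; _⊔_)
  import Data.Rational.Properties as ℚₚ
  open import Data.Nat using (_∸_; _!)
  open import Data.Nat.Combinatorics using (_C_)
  open import Data.Nat.Tactic.RingSolver using () renaming (solve-∀ to solve-∀ℕ)
  import Data.Fin.Properties as Finₚ
  open import Data.Sum using (_⊎_; inj₁; inj₂)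
  open import Data.Empty using (⊥-elim)
  open import Data.Unit using (tt)
  open import Data.List.Properties using (length-filter; filter-accept; filter-reject; ++-assoc; ++-identityʳ; take++drop≡id; drop-all)
  open import Data.List.Membership.Propositional using (_∈_)
  open import Data.List.Relation.Binary.Permutation.Propositional using (_↭_; ↭-sym; ↭⇒↭ₛ)
  open import Data.List.Relation.Binary.Permutation.Propositional.Properties using (↭-length; filter-↭)
  open import Data.List.Relation.Binary.Permutation.Setoid.Properties (setoid (Fin N)) using (Unique-resp-↭)
  open import Data.List.Relation.Unary.Unique.Propositional using (Unique; []; _∷_)
  import Data.List.Relation.Unary.Unique.Propositional.Properties as Unique
  import Data.List.Relation.Unary.AllPairs as AllPairs
  open import Data.Product.Relation.Binary.Lex.Strict using (×-Lex; ×-isStrictTotalOrder; ×-decidable)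
  open import Relation.Binary using (IsStrictTotalOrder; Decidable; tri<; tri≈; tri>)
  import Relation.Binary.Construct.On as On
  open import Relation.Nullary using (¬_; Dec; does; yes; no)
  open import Relation.Nullary.Decidable using (dec-true; dec-false)
  open import Function using (_on_)
  open import Algebra.Properties.Monoid.Sum ℚₚ.+-0-monoid using (sum)
  open import Tactic.RingSolver using () renaming (solve-∀ to solve-∀ℚ)

  key : Fin N → ℚ × ℕ
  key x = v x , toℕ x

  _≺_ : Fin N → Fin N → Set
  _≺_ = ×-Lex _≡_ ℚ._<_ ℕ._<_ on key

  _≺?_ : Decidable _≺_
  x ≺? y = ×-decidable ℚₚ._≟_ ℚₚ._<?_ ℕₚ._<?_ (key x) (key y)

  ≺-isStrictTotalOrder : IsStrictTotalOrder _ _≺_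
  ≺-isStrictTotalOrder =
    On.isStrictTotalOrder key (×-isStrictTotalOrder ℚₚ.<-isStrictTotalOrder ℕₚ.<-isStrictTotalOrder)

  open IsStrictTotalOrder ≺-isStrictTotalOrder using (compare) renaming (trans to ≺-trans; asym to ≺-asym)

  ≺-irrefl : ∀ x → ¬ x ≺ x
  ≺-irrefl x = IsStrictTotalOrder.irrefl ≺-isStrictTotalOrder (refl , refl)

  ≺-connex : ∀ {x y} → x ≢ y → x ≺ y ⊎ y ≺ x
  ≺-connex {x} {y} x≢y with compare x y
  ... | tri< x≺y _ _          = inj₁ x≺y
  ... | tri≈ _ (_ , toℕ≡) _   = ⊥-elim (x≢y (Finₚ.toℕ-injective toℕ≡))
  ... | tri> _ _ y≺x          = inj₂ y≺x

  ≺⇒≤ : ∀ {x y} → x ≺ y → v x ℚ.≤ v y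
  ≺⇒≤ (inj₁ vx<vy)       = ℚₚ.<⇒≤ vx<vy
  ≺⇒≤ (inj₂ (vx≡vy , _)) = ℚₚ.≤-reflexive vx≡vy

  -- below y x is definitionally Defs' x ≺ᵇ y, the comparison used by acceptProb.
  below : Fin N → Fin N → Bool
  below y x = does (x ≺? y)

  below-≺ : ∀ {x y} → x ≺ y → below y x ≡ true
  below-≺ {x} {y} = dec-true (x ≺? y)

  below-⊀ : ∀ {x y} → ¬ x ≺ y → below y x ≡ false
  below-⊀ {x} {y} = dec-false (x ≺? y)

  ≺⇒below : ∀ {x y} → x ≺ y → T (below y x)
  ≺⇒below x≺y = subst T (sym (below-≺ x≺y)) tt

  below⇒≺ : ∀ {x y} → T (below y x) → x ≺ y
  below⇒≺ {x} {y} = sound (x ≺? y)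
    where
    sound : ∀ {A : Set} (a? : Dec A) → T (does a?) → A
    sound (yes a) _ = a

  rank : Fin N → List (Fin N) → ℕ
  rank y xs = length (filterᵇ (below y) xs)

  rank-↭ : ∀ y {xs ys} → xs ↭ ys → rank y xs ≡ rank y ys
  rank-↭ y xs↭ys = ↭-length (filter-↭ (T? ∘ below y) xs↭ys)

  rank-∷-≺ : ∀ {x y} xs → x ≺ y → rank y (x ∷ xs) ≡ suc (rank y xs)
  rank-∷-≺ {y = y} xs x≺y = cong length (filter-accept (T? ∘ below y) (≺⇒below x≺y))

  rank-∷-⊀ : ∀ {x y} xs → ¬ x ≺ y → rank y (x ∷ xs) ≡ rank y xs
  rank-∷-⊀ {y = y} xs x⊀y = cong length (filter-reject (T? ∘ below y) (subst T (below-⊀ x⊀y)))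

  rank-removed : ∀ {R x R′} y → R ↭ x ∷ R′ → x ≺ y → rank y R′ ≡ rank y R ∸ 1
  rank-removed y R↭ x≺y = sym (trans (cong (_∸ 1) (rank-↭ y R↭)) (cong (_∸ 1) (rank-∷-≺ _ x≺y)))

  rank-kept : ∀ {R x R′} y → R ↭ x ∷ R′ → ¬ x ≺ y → rank y R′ ≡ rank y R
  rank-kept y R↭ x⊀y = sym (trans (rank-↭ y R↭) (rank-∷-⊀ _ x⊀y))

  rank-picked : ∀ R → All (λ p → rank (proj₁ p) (proj₂ p) ≡ rank (proj₁ p) R) (picks R)
  rank-picked R = All.map (λ {p} R↭ → rank-kept (proj₁ p) R↭ (≺-irrefl (proj₁ p))) (picks-↭ R)

  unique-picked : ∀ {R} → Unique R → All (λ p → Unique (proj₂ p)) (picks R)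
  unique-picked {R} u = All.map (λ R↭ → AllPairs.tail (Unique-resp-↭ (↭⇒↭ₛ R↭) u)) (picks-↭ R)

  rank-punchIn : ∀ {z x R} → x ∈ R → z ≢ x → rank x (z ∷ R) ≡ punchInℕ (rank z R) (rank x R)
  rank-punchIn {z} {x} {R} x∈R z≢x with ≺-connex z≢x
  ... | inj₁ z≺x = trans (rank-∷-≺ R z≺x) (sym (punchInℕ-≤ below-z⊆below-x))
    where
    below-z⊆below-x : rank z R ≤ rank x R
    below-z⊆below-x = length-filter-mono (λ y y≺z → ≺⇒below (≺-trans (below⇒≺ y≺z) z≺x)) R
  ... | inj₂ x≺z = trans (rank-∷-⊀ R (≺-asym x≺z)) (sym (punchInℕ-> below-x⊂below-z))
    where
    below-x⊂below-z : rank x R < rank z R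
    below-x⊂below-z =
      length-filter-mono-< (λ y y≺x → ≺⇒below (≺-trans (below⇒≺ y≺x) x≺z)) x∈R (≺-irrefl x ∘ below⇒≺) (≺⇒below x≺z)

  ∑-rank : ∀ {R} → Unique R → ∀ (H : ℕ → ℚ) → ∑[ x ∈ R ] H (rank x R) ≡ sum (λ (i : Fin (length R)) → H (toℕ i))
  ∑-rank {[]}    []          H = refl
  ∑-rank {z ∷ R} (z∉R ∷ uR) H = begin
    H (rank z (z ∷ R)) + ∑[ x ∈ R ] H (rank x (z ∷ R))
      ≡⟨ cong₂ _+_ (cong H (rank-∷-⊀ R (≺-irrefl z))) (∑-cong-local (All.tabulate (λ x∈R → cong H (rank-punchIn x∈R (All.lookup z∉R x∈R))))) ⟩
    H (rank z R) + ∑[ x ∈ R ] H (punchInℕ (rank z R) (rank x R))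
      ≡⟨ cong (H (rank z R) +_) (∑-rank uR (H ∘ punchInℕ (rank z R))) ⟩
    H (rank z R) + sum (λ (j : Fin (length R)) → H (punchInℕ (rank z R) (toℕ j)))
      ≡⟨ sum-punchIn H (length-filter (T? ∘ below z) R) ⟩
    sum (λ (i : Fin (suc (length R))) → H (toℕ i))
      ∎
    where open ≡-Reasoning

  ∑-rank-C : ∀ {R} → Unique R → ∀ k → ∑[ x ∈ R ] fromℕ (rank x R C k) ≡ fromℕ (length R C suc k)
  ∑-rank-C {R} u k = trans (∑-rank u (λ r → fromℕ (r C k))) (sum-C (length R) k)

  ∑-picks-rank : ∀ R (g : Bool → Fin N → ℕ → ℚ) →
    ∑[ p ∈ picks R ] ∑[ y ∈ proj₂ p ] g (below y (proj₁ p)) y (rank y (proj₂ p)) ≡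
    ∑[ p ∈ picks R ] (fromℕ (rank (proj₁ p) R) * g true (proj₁ p) (rank (proj₁ p) R ∸ 1)
                     + fromℕ (length (proj₂ p) ∸ rank (proj₁ p) R) * g false (proj₁ p) (rank (proj₁ p) R))
  ∑-picks-rank R g = begin
    ∑[ p ∈ picks R ] ∑[ y ∈ proj₂ p ] g (below y (proj₁ p)) y (rank y (proj₂ p))
      ≡⟨ ∑-cong-local (All.map (λ {p} R↭ → ∑-cong-≗ (proj₂ p) (relative-rank R↭)) (picks-↭ R)) ⟩
    ∑[ p ∈ picks R ] ∑[ y ∈ proj₂ p ] G (proj₁ p) y
      ≡⟨ ∑-picks-swap R G ⟩
    ∑[ p ∈ picks R ] ∑[ x ∈ proj₂ p ] G x (proj₁ p)
      ≡⟨ ∑-cong-local (All.map (λ {p} r≡ → trans (∑-if (below (proj₁ p)) (proj₂ p) (up (proj₁ p)) (same (proj₁ p)))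
                                                  (cong (λ r → fromℕ r * up (proj₁ p) + fromℕ (length (proj₂ p) ∸ r) * same (proj₁ p)) r≡))
                               (rank-picked R)) ⟩
    ∑[ p ∈ picks R ] (fromℕ (rank (proj₁ p) R) * up (proj₁ p) + fromℕ (length (proj₂ p) ∸ rank (proj₁ p) R) * same (proj₁ p))
      ∎
    where
    open ≡-Reasoning
    up same : Fin N → ℚ
    up y   = g true y (rank y R ∸ 1)
    same y = g false y (rank y R)
    G : Fin N → Fin N → ℚ
    G x y = if below y x then up y else same y
    relative-rank : ∀ {x R′} → R ↭ x ∷ R′ → ∀ y → g (below y x) y (rank y R′) ≡ G x y
    relative-rank {x} {R′} R↭ y with x ≺? y
    ... | yes x≺y = trans (cong (λ b → g b y (rank y R′)) (below-≺ x≺y))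
                          (trans (cong (g true y) (rank-removed y R↭ x≺y))
                                 (cong (λ b → if b then up y else same y) (sym (below-≺ x≺y))))
    ... | no x⊀y  = trans (cong (λ b → g b y (rank y R′)) (below-⊀ x⊀y))
                          (trans (cong (g false y) (rank-kept y R↭ x⊀y))
                                 (cong (λ b → if b then up y else same y) (sym (below-⊀ x⊀y))))

  ∑-picks-below : ∀ R y (f : ℕ → ℚ) →
    ∑[ p ∈ picks R ] (𝟙 (below y (proj₁ p)) * f (rank y (proj₂ p))) ≡ fromℕ (rank y R) * f (rank y R ∸ 1)
  ∑-picks-below R y f = begin
    ∑[ p ∈ picks R ] (𝟙 (below y (proj₁ p)) * f (rank y (proj₂ p)))
      ≡⟨ ∑-cong-local (All.map (λ {p} R↭ → relative-rank R↭) (picks-↭ R)) ⟩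
    ∑[ p ∈ picks R ] (if below y (proj₁ p) then f (rank y R ∸ 1) else 0ℚ)
      ≡⟨ ∑-picks R (λ x → if below y x then f (rank y R ∸ 1) else 0ℚ) ⟩
    ∑[ x ∈ R ] (if below y x then f (rank y R ∸ 1) else 0ℚ)
      ≡⟨ ∑-if (below y) R (f (rank y R ∸ 1)) 0ℚ ⟩
    fromℕ (rank y R) * f (rank y R ∸ 1) + fromℕ (length R ∸ rank y R) * 0ℚ
      ≡⟨ trans (cong (fromℕ (rank y R) * f (rank y R ∸ 1) +_) (ℚₚ.*-zeroʳ (fromℕ (length R ∸ rank y R)))) (ℚₚ.+-identityʳ _) ⟩
    fromℕ (rank y R) * f (rank y R ∸ 1)
      ∎
    where
    open ≡-Reasoning
    relative-rank : ∀ {x R′} → R ↭ x ∷ R′ →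
      𝟙 (below y x) * f (rank y R′) ≡ (if below y x then f (rank y R ∸ 1) else 0ℚ)
    relative-rank {x} {R′} R↭ with x ≺? y
    ... | yes x≺y = trans (𝟙*≡if (below y x) (f (rank y R′)))
                          (trans (cong (λ b → if b then f (rank y R′) else 0ℚ) (below-≺ x≺y))
                          (trans (cong f (rank-removed y R↭ x≺y)) (cong (λ b → if b then f (rank y R ∸ 1) else 0ℚ) (sym (below-≺ x≺y)))))
    ... | no x⊀y  = trans (𝟙*≡if (below y x) (f (rank y R′)))
                          (trans (cong (λ b → if b then f (rank y R′) else 0ℚ) (below-⊀ x⊀y))
                          (cong (λ b → if b then f (rank y R ∸ 1) else 0ℚ) (sym (below-⊀ x⊀y))))

  acceptProb-rank : ∀ k T c → acceptProb v k T c ≡ fromℕ (rank c T C k) * ratio 1 (length T C k)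
  acceptProb-rank k T c = trans (cong₂ ratio (length-filter-all-choose (below c) k T) (length-choose k T))
                                (ratio≡fromℕ*ratio1 (rank c T C k) (length T C k))

  rejectAllProb : ℕ → List (Fin N) → List (Fin N) → ℚ
  rejectAllProb k T []       = 1ℚ
  rejectAllProb k T (c ∷ cs) = (1ℚ - acceptProb v k T c) * rejectAllProb k (T ++ [ c ]) cs

  rejectAllProb-snoc : ∀ k T cs x →
    rejectAllProb k T (cs ++ [ x ]) ≡ rejectAllProb k T cs * (1ℚ - acceptProb v k (T ++ cs) x)
  rejectAllProb-snoc k T []       x =
    trans (ℚₚ.*-identityʳ _) (trans (cong (λ T′ → 1ℚ - acceptProb v k T′ x) (sym (++-identityʳ T))) (sym (ℚₚ.*-identityˡ _)))
  rejectAllProb-snoc k T (c ∷ cs) x = begin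
    (1ℚ - acceptProb v k T c) * rejectAllProb k (T ++ [ c ]) (cs ++ [ x ])
      ≡⟨ cong ((1ℚ - acceptProb v k T c) *_) (rejectAllProb-snoc k (T ++ [ c ]) cs x) ⟩
    (1ℚ - acceptProb v k T c) * (rejectAllProb k (T ++ [ c ]) cs * (1ℚ - acceptProb v k ((T ++ [ c ]) ++ cs) x))
      ≡⟨ cong (λ T′ → (1ℚ - acceptProb v k T c) * (rejectAllProb k (T ++ [ c ]) cs * (1ℚ - acceptProb v k T′ x))) (++-assoc T [ c ] cs) ⟩
    (1ℚ - acceptProb v k T c) * (rejectAllProb k (T ++ [ c ]) cs * (1ℚ - acceptProb v k (T ++ c ∷ cs) x))
      ≡⟨ sym (ℚₚ.*-assoc (1ℚ - acceptProb v k T c) (rejectAllProb k (T ++ [ c ]) cs) (1ℚ - acceptProb v k (T ++ c ∷ cs) x)) ⟩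
    (1ℚ - acceptProb v k T c) * rejectAllProb k (T ++ [ c ]) cs * (1ℚ - acceptProb v k (T ++ c ∷ cs) x)
      ∎
    where open ≡-Reasoning

  algValue-snoc : ∀ k T cs x →
    algValue v k T (cs ++ [ x ]) ≡ algValue v k T cs + rejectAllProb k T cs * (acceptProb v k (T ++ cs) x * v x)
  algValue-snoc k T [] x = begin
    acceptProb v k T x * v x + (1ℚ - acceptProb v k T x) * 0ℚ
      ≡⟨ lastRound (acceptProb v k T x) (v x) ⟩
    0ℚ + 1ℚ * (acceptProb v k T x * v x)
      ≡⟨ cong (λ T′ → 0ℚ + 1ℚ * (acceptProb v k T′ x * v x)) (sym (++-identityʳ T)) ⟩
    0ℚ + 1ℚ * (acceptProb v k (T ++ []) x * v x)
      ∎
    where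
    open ≡-Reasoning
    lastRound : ∀ a w → a * w + (1ℚ - a) * 0ℚ ≡ 0ℚ + 1ℚ * (a * w)
    lastRound = solve-∀ℚ ℚ-ring
  algValue-snoc k T (c ∷ cs) x = begin
    a * v c + (1ℚ - a) * algValue v k (T ++ [ c ]) (cs ++ [ x ])
      ≡⟨ cong (λ w → a * v c + (1ℚ - a) * w) (algValue-snoc k (T ++ [ c ]) cs x) ⟩
    a * v c + (1ℚ - a) * (algValue v k (T ++ [ c ]) cs + rejectAllProb k (T ++ [ c ]) cs * (acceptProb v k ((T ++ [ c ]) ++ cs) x * v x))
      ≡⟨ cong (λ T′ → a * v c + (1ℚ - a) * (algValue v k (T ++ [ c ]) cs + rejectAllProb k (T ++ [ c ]) cs * (acceptProb v k T′ x * v x))) (++-assoc T [ c ] cs) ⟩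
    a * v c + (1ℚ - a) * (algValue v k (T ++ [ c ]) cs + rejectAllProb k (T ++ [ c ]) cs * (acceptProb v k (T ++ c ∷ cs) x * v x))
      ≡⟨ regroup (a * v c) (1ℚ - a) (algValue v k (T ++ [ c ]) cs) (rejectAllProb k (T ++ [ c ]) cs) (acceptProb v k (T ++ c ∷ cs) x * v x) ⟩
    (a * v c + (1ℚ - a) * algValue v k (T ++ [ c ]) cs) + ((1ℚ - a) * rejectAllProb k (T ++ [ c ]) cs) * (acceptProb v k (T ++ c ∷ cs) x * v x)
      ∎
    where
    open ≡-Reasoning
    a : ℚ
    a = acceptProb v k T c
    regroup : ∀ p q A S X → p + q * (A + S * X) ≡ (p + q * A) + (q * S) * X
    regroup = solve-∀ℚ ℚ-ring

  beats : Fin N → List (Fin N) → ℚ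
  beats y D = 𝟙 (allᵇ (below y) D)

  above : Fin N → (Fin N → ℚ) → Fin N → ℚ
  above z u y = 𝟙 (below y z) * u y

  -- For L without repetitions, top u L is u at the ≺-maximum of L (0 if L is empty):
  -- either the head beats the rest, or the maximum lies in the rest, above the head.
  top : (Fin N → ℚ) → List (Fin N) → ℚ
  top u []      = 0ℚ
  top u (z ∷ L) = beats z L * u z + top (above z u) L

  top-cong : ∀ {u w} L → (∀ y → u y ≡ w y) → top u L ≡ top w L
  top-cong []      e = refl
  top-cong (z ∷ L) e = cong₂ _+_ (cong (beats z L *_) (e z)) (top-cong L (λ y → cong (𝟙 (below y z) *_) (e y)))

  beats-snoc : ∀ y D x → beats y (D ++ [ x ]) ≡ beats y D * 𝟙 (below y x)
  beats-snoc y D x = trans (cong 𝟙 (allᵇ-++ (below y) D x)) (𝟙-∧ (allᵇ (below y) D) (below y x))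

  top-snoc : ∀ u D x → top u (D ++ [ x ]) ≡ top (above x u) D + u x * beats x D
  top-snoc u []      x = swap (u x)
    where
    swap : ∀ a → 1ℚ * a + 0ℚ ≡ 0ℚ + a * 1ℚ
    swap = solve-∀ℚ ℚ-ring
  top-snoc u (z ∷ D) x = begin
    beats z (D ++ [ x ]) * u z + top (above z u) (D ++ [ x ])
      ≡⟨ cong₂ _+_ (cong (_* u z) (beats-snoc z D x)) (top-snoc (above z u) D x) ⟩
    beats z D * 𝟙 (below z x) * u z + (top (above x (above z u)) D + 𝟙 (below x z) * u x * beats x D)
      ≡⟨ cong (λ t → beats z D * 𝟙 (below z x) * u z + (t + 𝟙 (below x z) * u x * beats x D)) (top-cong D (λ y → swap (𝟙 (below y x)) (𝟙 (below y z)) (u y))) ⟩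
    beats z D * 𝟙 (below z x) * u z + (top (above z (above x u)) D + 𝟙 (below x z) * u x * beats x D)
      ≡⟨ regroup (beats z D) (𝟙 (below z x)) (u z) (top (above z (above x u)) D) (𝟙 (below x z)) (u x) (beats x D) ⟩
    beats z D * (𝟙 (below z x) * u z) + top (above z (above x u)) D + u x * (𝟙 (below x z) * beats x D)
      ≡⟨ cong (λ b → beats z D * (𝟙 (below z x) * u z) + top (above z (above x u)) D + u x * b) (sym (𝟙-∧ (below x z) (allᵇ (below x) D))) ⟩
    beats z D * (𝟙 (below z x) * u z) + top (above z (above x u)) D + u x * beats x (z ∷ D)
      ∎
    where
    open ≡-Reasoning
    swap : ∀ a b c → a * (b * c) ≡ b * (a * c)
    swap = solve-∀ℚ ℚ-ring
    regroup : ∀ B a U P c W E → B * a * U + (P + c * W * E) ≡ B * (a * U) + P + W * (c * E)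
    regroup = solve-∀ℚ ℚ-ring

  above-above-≺ : ∀ {w z} u → w ≺ z → ∀ y → above z (above w u) y ≡ above z u y
  above-above-≺ {w} {z} u w≺z y with z ≺? y
  ... | yes z≺y = cong (𝟙 (below y z) *_) (trans (cong (λ b → 𝟙 b * u y) (below-≺ (≺-trans w≺z z≺y))) (ℚₚ.*-identityˡ (u y)))
  ... | no z⊀y  = trans (cong (λ b → 𝟙 b * above w u y) (below-⊀ z⊀y))
                        (trans (ℚₚ.*-zeroˡ (above w u y)) (sym (trans (cong (λ b → 𝟙 b * u y) (below-⊀ z⊀y)) (ℚₚ.*-zeroˡ (u y)))))

  above-above-≻ : ∀ {w z} u → z ≺ w → ∀ y → above z (above w u) y ≡ above w u y
  above-above-≻ {w} {z} u z≺w y with w ≺? y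
  ... | yes w≺y = trans (cong (λ b → 𝟙 b * above w u y) (below-≺ (≺-trans z≺w w≺y))) (ℚₚ.*-identityˡ (above w u y))
  ... | no w⊀y  = trans (cong (λ b → 𝟙 (below y z) * (𝟙 b * u y)) (below-⊀ w⊀y))
                        (trans (vanish (𝟙 (below y z)) (u y)) (sym (trans (cong (λ b → 𝟙 b * u y) (below-⊀ w⊀y)) (ℚₚ.*-zeroˡ (u y)))))
    where
    vanish : ∀ a b → a * (0ℚ * b) ≡ 0ℚ
    vanish = solve-∀ℚ ℚ-ring

  ⊔-optValue≡top : (∀ i → 0ℚ ℚ.≤ v i) → ∀ w L → Unique (w ∷ L) →
    v w ⊔ optValue v L ≡ beats w L * v w + top (above w v) L
  ⊔-optValue≡top nonneg w []      _ = trans (ℚₚ.p≥q⇒p⊔q≡p (nonneg w)) (sym (trans (ℚₚ.+-identityʳ _) (ℚₚ.*-identityˡ (v w))))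
  ⊔-optValue≡top nonneg w (z ∷ L) ((w≢z ∷ w∉L) ∷ uL) with ≺-connex w≢z
  ... | inj₁ w≺z = begin
    v w ⊔ (v z ⊔ optValue v L)
      ≡⟨ sym (ℚₚ.⊔-assoc (v w) (v z) (optValue v L)) ⟩
    (v w ⊔ v z) ⊔ optValue v L
      ≡⟨ cong (_⊔ optValue v L) (ℚₚ.p≤q⇒p⊔q≡q (≺⇒≤ w≺z)) ⟩
    v z ⊔ optValue v L
      ≡⟨ ⊔-optValue≡top nonneg z L uL ⟩
    beats z L * v z + top (above z v) L
      ≡⟨ padding (beats z L) (v z) (top (above z v) L) (v w) ⟩
    0ℚ * v w + (beats z L * (1ℚ * v z) + top (above z v) L)
      ≡⟨ cong (λ t → 0ℚ * v w + (beats z L * (1ℚ * v z) + t)) (sym (top-cong L (above-above-≺ v w≺z))) ⟩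
    0ℚ * v w + (beats z L * (1ℚ * v z) + top (above z (above w v)) L)
      ≡⟨ cong₂ (λ a b → 𝟙 (a ∧ allᵇ (below w) L) * v w + (beats z L * (𝟙 b * v z) + top (above z (above w v)) L))
               (sym (below-⊀ (≺-asym w≺z))) (sym (below-≺ w≺z)) ⟩
    beats w (z ∷ L) * v w + (beats z L * above w v z + top (above z (above w v)) L)
      ∎
    where
    open ≡-Reasoning
    padding : ∀ b x t y → b * x + t ≡ 0ℚ * y + (b * (1ℚ * x) + t)
    padding = solve-∀ℚ ℚ-ring
  ... | inj₂ z≺w = begin
    v w ⊔ (v z ⊔ optValue v L)
      ≡⟨ sym (ℚₚ.⊔-assoc (v w) (v z) (optValue v L)) ⟩
    (v w ⊔ v z) ⊔ optValue v L
      ≡⟨ cong (_⊔ optValue v L) (ℚₚ.p≥q⇒p⊔q≡p (≺⇒≤ z≺w)) ⟩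
    v w ⊔ optValue v L
      ≡⟨ ⊔-optValue≡top nonneg w L (w∉L ∷ AllPairs.tail uL) ⟩
    beats w L * v w + top (above w v) L
      ≡⟨ padding (beats w L * v w) (beats z L) (v z) (top (above w v) L) ⟩
    beats w L * v w + (beats z L * (0ℚ * v z) + top (above w v) L)
      ≡⟨ cong (λ t → beats w L * v w + (beats z L * (0ℚ * v z) + t)) (sym (top-cong L (above-above-≻ v z≺w))) ⟩
    beats w L * v w + (beats z L * (0ℚ * v z) + top (above z (above w v)) L)
      ≡⟨ cong₂ (λ a b → 𝟙 (a ∧ allᵇ (below w) L) * v w + (beats z L * (𝟙 b * v z) + top (above z (above w v)) L))
               (sym (below-≺ z≺w)) (sym (below-⊀ (≺-asym z≺w))) ⟩
    beats w (z ∷ L) * v w + (beats z L * above w v z + top (above z (above w v)) L)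
      ∎
    where
    open ≡-Reasoning
    padding : ∀ a b x t → a + t ≡ a + (b * (0ℚ * x) + t)
    padding = solve-∀ℚ ℚ-ring

  optValue≡top : (∀ i → 0ℚ ℚ.≤ v i) → ∀ {L} → Unique L → optValue v L ≡ top v L
  optValue≡top nonneg {[]}    _ = refl
  optValue≡top nonneg {z ∷ L} u = ⊔-optValue≡top nonneg z L u

  module Analysis (k h : ℕ) (k<h : k < h) where

    open ≡-Reasoning

    rejects gain : List (Fin N) → ℚ
    rejects σ = rejectAllProb k (take h σ) (drop h σ)
    gain    σ = algValue v k (take h σ) (drop h σ)

    ρ β : ℚ
    ρ = ratio 1 (suc k)
    β = 1ℚ - ρ

    weight : List (Fin N) → Fin N → ℚ
    weight R y = v y * fromℕ (rank y R C k)

    -- M R is the expected maximum of a uniformly random (k+1)-subset of R: such a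
    -- subset has maximum y with probability (rank y R C k) / (length R C (k+1)).
    M : List (Fin N) → ℚ
    M R = ∑ R (weight R) * ratio 1 (length R C suc k)

    acceptProb-↭ : ∀ {σ R : List (Fin N)} x → σ ↭ R → acceptProb v k σ x ≡ fromℕ (rank x R C k) * ratio 1 (length R C k)
    acceptProb-↭ {σ} x σ↭R = trans (acceptProb-rank k σ x)
      (cong₂ (λ r l → fromℕ (r C k) * ratio 1 (l C k)) (rank-↭ x σ↭R) (↭-length σ↭R))

    rejects-snoc : ∀ σ x → h ≤ length σ → rejects (σ ++ [ x ]) ≡ rejects σ * (1ℚ - acceptProb v k σ x)
    rejects-snoc σ x h≤ = begin
      rejectAllProb k (take h (σ ++ [ x ])) (drop h (σ ++ [ x ]))
        ≡⟨ cong₂ (rejectAllProb k) (take-++ˡ h σ [ x ] h≤) (drop-++ˡ h σ [ x ] h≤) ⟩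
      rejectAllProb k (take h σ) (drop h σ ++ [ x ])
        ≡⟨ rejectAllProb-snoc k (take h σ) (drop h σ) x ⟩
      rejects σ * (1ℚ - acceptProb v k (take h σ ++ drop h σ) x)
        ≡⟨ cong (λ T → rejects σ * (1ℚ - acceptProb v k T x)) (take++drop≡id h σ) ⟩
      rejects σ * (1ℚ - acceptProb v k σ x)
        ∎

    gain-snoc : ∀ σ x → h ≤ length σ → gain (σ ++ [ x ]) ≡ gain σ + rejects σ * (acceptProb v k σ x * v x)
    gain-snoc σ x h≤ = begin
      algValue v k (take h (σ ++ [ x ])) (drop h (σ ++ [ x ]))
        ≡⟨ cong₂ (algValue v k) (take-++ˡ h σ [ x ] h≤) (drop-++ˡ h σ [ x ] h≤) ⟩
      algValue v k (take h σ) (drop h σ ++ [ x ])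
        ≡⟨ algValue-snoc k (take h σ) (drop h σ) x ⟩
      gain σ + rejects σ * (acceptProb v k (take h σ ++ drop h σ) x * v x)
        ≡⟨ cong (λ T → gain σ + rejects σ * (acceptProb v k T x * v x)) (take++drop≡id h σ) ⟩
      gain σ + rejects σ * (acceptProb v k σ x * v x)
        ∎

    online-empty : ∀ {σ R : List (Fin N)} → σ ↭ R → length R ≡ h → drop h σ ≡ []
    online-empty {σ} σ↭R |R|≡h = drop-all h σ (ℕₚ.≤-reflexive (trans (↭-length σ↭R) |R|≡h))

    h≤length : ∀ t {σ R : List (Fin N)} → σ ↭ R → length R ≡ t ℕ.+ h → h ≤ length σ
    h≤length t σ↭R |R|≡ = subst (h ≤_) (sym (trans (↭-length σ↭R) |R|≡)) (ℕₚ.m≤n+m h t)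

    picked-length : ∀ {t} {R R′ : List (Fin N)} {x} → length R ≡ suc t ℕ.+ h → R ↭ x ∷ R′ → length R′ ≡ t ℕ.+ h
    picked-length |R|≡ R↭ = ℕₚ.suc-injective (trans (sym (↭-length R↭)) |R|≡)

    k≤t+h : ∀ t → k ≤ t ℕ.+ h
    k≤t+h t = ℕₚ.≤-trans (ℕₚ.<⇒≤ k<h) (ℕₚ.m≤n+m h t)

    absorption-ratio : ∀ t → fromℕ (suc (t ℕ.+ h) C suc k) * ratio 1 ((t ℕ.+ h) C k) ≡ fromℕ (suc (t ℕ.+ h)) * ρ
    absorption-ratio t = ratio1-cross {suc (t ℕ.+ h) C suc k} {suc (t ℕ.+ h)} {(t ℕ.+ h) C k} {suc k}
      (trans (ℕₚ.*-comm (suc (t ℕ.+ h) C suc k) (suc k)) ([1+k]*[1+n]C[1+k]≡[1+n]*nCk (t ℕ.+ h) k))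
      where
      instance
        [t+h]Ck≢0 : ℕ.NonZero ((t ℕ.+ h) C k)
        [t+h]Ck≢0 = ℕ.>-nonZero (nCk>0 (k≤t+h t))

    ∑-rejects : ∀ t R → length R ≡ t ℕ.+ h → Unique R →
      ∑[ σ ∈ perms R ] rejects σ ≡ fromℕ (length R !) * β ^ℚ t
    ∑-rejects zero R |R|≡h _ = begin
      ∑[ σ ∈ perms R ] rejects σ
        ≡⟨ ∑-cong-local (All.map (λ σ↭R → cong (rejectAllProb k _) (online-empty σ↭R |R|≡h)) (perms-↭ R)) ⟩
      ∑[ σ ∈ perms R ] 1ℚ
        ≡⟨ ∑-perms-const 1ℚ R ⟩
      fromℕ (length R !) * 1ℚ
        ∎
    ∑-rejects (suc t) R@(x₀ ∷ R₀) |R|≡ u = begin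
      ∑ (perms R) rejects
        ≡⟨ ∑-perms-last x₀ R₀ rejects ⟩
      ∑[ p ∈ picks R ] ∑[ σ ∈ perms (proj₂ p) ] rejects (σ ++ [ proj₁ p ])
        ≡⟨ ∑-cong-local (All.zipWith (λ { (R↭ , u′) → step R↭ u′ }) (picks-↭ R , unique-picked u)) ⟩
      ∑[ p ∈ picks R ] (c * (1ℚ - fromℕ (rank (proj₁ p) R C k) * r))
        ≡⟨ ∑-picks R (λ x → c * (1ℚ - fromℕ (rank x R C k) * r)) ⟩
      ∑[ x ∈ R ] (c * (1ℚ - fromℕ (rank x R C k) * r))
        ≡⟨ ∑-*ˡ c R (λ x → 1ℚ - fromℕ (rank x R C k) * r) ⟩
      c * ∑[ x ∈ R ] (1ℚ - fromℕ (rank x R C k) * r)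
        ≡⟨ cong (c *_) (trans (∑-distrib-sub R (λ _ → 1ℚ) (λ x → fromℕ (rank x R C k) * r))
                              (cong₂ _-_ (trans (∑-const 1ℚ R) (ℚₚ.*-identityʳ (fromℕ (length R))))
                                         (∑-*ʳ r R (λ x → fromℕ (rank x R C k))))) ⟩
      c * (fromℕ (length R) - ∑ R (λ x → fromℕ (rank x R C k)) * r)
        ≡⟨ cong (λ s → c * (fromℕ (length R) - s * r)) (∑-rank-C u k) ⟩
      c * (fromℕ (length R) - fromℕ (length R C suc k) * r)
        ≡⟨ cong (λ l → c * (fromℕ l - fromℕ (l C suc k) * r)) |R|≡ ⟩
      c * (fromℕ m - fromℕ (m C suc k) * r)
        ≡⟨ cong (λ s → c * (fromℕ m - s)) (absorption-ratio t) ⟩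
      c * (fromℕ m - fromℕ m * ρ)
        ≡⟨ regroup (fromℕ ((t ℕ.+ h) !)) (β ^ℚ t) (fromℕ m) ρ ⟩
      fromℕ m * fromℕ ((t ℕ.+ h) !) * β ^ℚ suc t
        ≡⟨ cong (_* β ^ℚ suc t) (trans (sym (fromℕ-* m ((t ℕ.+ h) !))) (cong (λ l → fromℕ (l !)) (sym |R|≡))) ⟩
      fromℕ (length R !) * β ^ℚ suc t
        ∎
      where
      m : ℕ
      m = suc (t ℕ.+ h)
      c r : ℚ
      c = fromℕ ((t ℕ.+ h) !) * β ^ℚ t
      r = ratio 1 ((t ℕ.+ h) C k)
      regroup : ∀ F B m ρ → F * B * (m - m * ρ) ≡ m * F * ((1ℚ - ρ) * B)
      regroup = solve-∀ℚ ℚ-ring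
      step : ∀ {x R′} → R ↭ x ∷ R′ → Unique R′ →
        ∑[ σ ∈ perms R′ ] rejects (σ ++ [ x ]) ≡ c * (1ℚ - fromℕ (rank x R C k) * r)
      step {x} {R′} R↭ u′ = begin
        ∑[ σ ∈ perms R′ ] rejects (σ ++ [ x ])
          ≡⟨ ∑-cong-local (All.map (λ {σ} σ↭ → trans (rejects-snoc σ x (h≤length t σ↭ |R′|≡))
                                                      (cong (λ a → rejects σ * (1ℚ - a)) (acceptProb-↭ x σ↭)))
                                   (perms-↭ R′)) ⟩
        ∑[ σ ∈ perms R′ ] (rejects σ * (1ℚ - fromℕ (rank x R′ C k) * ratio 1 (length R′ C k)))
          ≡⟨ ∑-*ʳ _ (perms R′) rejects ⟩
        ∑ (perms R′) rejects * (1ℚ - fromℕ (rank x R′ C k) * ratio 1 (length R′ C k))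
          ≡⟨ cong₂ (λ s l → s * (1ℚ - fromℕ (rank x R′ C k) * ratio 1 (l C k))) (∑-rejects t R′ |R′|≡ u′) |R′|≡ ⟩
        fromℕ (length R′ !) * β ^ℚ t * (1ℚ - fromℕ (rank x R′ C k) * r)
          ≡⟨ cong₂ (λ l q → fromℕ (l !) * β ^ℚ t * (1ℚ - fromℕ (q C k) * r)) |R′|≡ (rank-kept x R↭ (≺-irrefl x)) ⟩
        c * (1ℚ - fromℕ (rank x R C k) * r)
          ∎
        where
        |R′|≡ : length R′ ≡ t ℕ.+ h
        |R′|≡ = picked-length |R|≡ R↭

    accept-ratio : ∀ t → ratio 1 ((t ℕ.+ h) C k) ≡ fromℕ (suc (t ℕ.+ h)) * ρ * ratio 1 (suc (t ℕ.+ h) C suc k)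
    accept-ratio t = begin
      ratio 1 ((t ℕ.+ h) C k)
        ≡⟨ sym (ℚₚ.*-identityˡ _) ⟩
      1ℚ * ratio 1 ((t ℕ.+ h) C k)
        ≡⟨ cong (_* ratio 1 ((t ℕ.+ h) C k)) (sym (fromℕ*ratio1≡1 (suc (t ℕ.+ h) C suc k))) ⟩
      fromℕ c * ratio 1 c * ratio 1 ((t ℕ.+ h) C k)
        ≡⟨ swap (fromℕ c) (ratio 1 c) (ratio 1 ((t ℕ.+ h) C k)) ⟩
      fromℕ c * ratio 1 ((t ℕ.+ h) C k) * ratio 1 c
        ≡⟨ cong (_* ratio 1 c) (absorption-ratio t) ⟩
      fromℕ (suc (t ℕ.+ h)) * ρ * ratio 1 c
        ∎
      where
      c : ℕ
      c = suc (t ℕ.+ h) C suc k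
      instance
        c≢0 : ℕ.NonZero c
        c≢0 = ℕ.>-nonZero (nCk>0 (s≤s (k≤t+h t)))
      swap : ∀ a b d → a * b * d ≡ a * d * b
      swap = solve-∀ℚ ℚ-ring

    deletion-ratio : ∀ t → fromℕ (t ℕ.+ h ∸ k) * ratio 1 ((t ℕ.+ h) C suc k) ≡ fromℕ (suc (t ℕ.+ h)) * ratio 1 (suc (t ℕ.+ h) C suc k)
    deletion-ratio t = ratio1-cross {t ℕ.+ h ∸ k} {suc (t ℕ.+ h)} {(t ℕ.+ h) C suc k} {suc (t ℕ.+ h) C suc k} ([n∸k]*[1+n]C[1+k]≡[1+n]*nC[1+k] (t ℕ.+ h) k)
      where
      instance
        [t+h]C[1+k]≢0 : ℕ.NonZero ((t ℕ.+ h) C suc k)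
        [t+h]C[1+k]≢0 = ℕ.>-nonZero (nCk>0 (ℕₚ.≤-trans k<h (ℕₚ.m≤n+m h t)))
        [1+t+h]C[1+k]≢0 : ℕ.NonZero (suc (t ℕ.+ h) C suc k)
        [1+t+h]C[1+k]≢0 = ℕ.>-nonZero (nCk>0 (s≤s (k≤t+h t)))

    ∑-picks-weight : ∀ t R → length R ≡ suc t ℕ.+ h →
      ∑[ p ∈ picks R ] ∑ (proj₂ p) (weight (proj₂ p)) ≡ fromℕ (t ℕ.+ h ∸ k) * ∑ R (weight R)
    ∑-picks-weight t R |R|≡ = begin
      ∑[ p ∈ picks R ] ∑ (proj₂ p) (weight (proj₂ p))
        ≡⟨ ∑-picks-rank R (λ _ y c → v y * fromℕ (c C k)) ⟩
      ∑[ p ∈ picks R ] (fromℕ (rank (proj₁ p) R) * (v (proj₁ p) * fromℕ ((rank (proj₁ p) R ∸ 1) C k))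
                        + fromℕ (length (proj₂ p) ∸ rank (proj₁ p) R) * weight R (proj₁ p))
        ≡⟨ ∑-cong-local (All.zipWith (λ { (R↭ , r≡) → deletion R↭ r≡ }) (picks-↭ R , rank-picked R)) ⟩
      ∑[ p ∈ picks R ] (fromℕ (t ℕ.+ h ∸ k) * weight R (proj₁ p))
        ≡⟨ ∑-picks R (λ y → fromℕ (t ℕ.+ h ∸ k) * weight R y) ⟩
      ∑[ y ∈ R ] (fromℕ (t ℕ.+ h ∸ k) * weight R y)
        ≡⟨ ∑-*ˡ (fromℕ (t ℕ.+ h ∸ k)) R (weight R) ⟩
      fromℕ (t ℕ.+ h ∸ k) * ∑ R (weight R)
        ∎
      where
      deletion : ∀ {y R′} → R ↭ y ∷ R′ → rank y R′ ≡ rank y R →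
        fromℕ (rank y R) * (v y * fromℕ ((rank y R ∸ 1) C k)) + fromℕ (length R′ ∸ rank y R) * weight R y
          ≡ fromℕ (t ℕ.+ h ∸ k) * weight R y
      deletion {y} {R′} R↭ r≡ = begin
        fromℕ r * (v y * fromℕ ((r ∸ 1) C k)) + fromℕ (length R′ ∸ r) * (v y * fromℕ (r C k))
          ≡⟨ cong (λ l → fromℕ r * (v y * fromℕ ((r ∸ 1) C k)) + fromℕ (l ∸ r) * (v y * fromℕ (r C k))) |R′|≡ ⟩
        fromℕ r * (v y * fromℕ ((r ∸ 1) C k)) + fromℕ (t ℕ.+ h ∸ r) * (v y * fromℕ (r C k))
          ≡⟨ factor (fromℕ r) (v y) (fromℕ ((r ∸ 1) C k)) (fromℕ (t ℕ.+ h ∸ r)) (fromℕ (r C k)) ⟩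
        v y * (fromℕ r * fromℕ ((r ∸ 1) C k) + fromℕ (t ℕ.+ h ∸ r) * fromℕ (r C k))
          ≡⟨ cong (v y *_) (sym (trans (fromℕ-+ (r ℕ.* ((r ∸ 1) C k)) ((t ℕ.+ h ∸ r) ℕ.* (r C k)))
                                       (cong₂ _+_ (fromℕ-* r ((r ∸ 1) C k)) (fromℕ-* (t ℕ.+ h ∸ r) (r C k))))) ⟩
        v y * fromℕ (r ℕ.* ((r ∸ 1) C k) ℕ.+ (t ℕ.+ h ∸ r) ℕ.* (r C k))
          ≡⟨ cong (λ n → v y * fromℕ n) (deletion-identity k (s≤s r≤)) ⟩
        v y * fromℕ ((t ℕ.+ h ∸ k) ℕ.* (r C k))
          ≡⟨ trans (cong (v y *_) (fromℕ-* (t ℕ.+ h ∸ k) (r C k))) (swap (v y) (fromℕ (t ℕ.+ h ∸ k)) (fromℕ (r C k))) ⟩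
        fromℕ (t ℕ.+ h ∸ k) * (v y * fromℕ (r C k))
          ∎
        where
        r : ℕ
        r = rank y R
        |R′|≡ : length R′ ≡ t ℕ.+ h
        |R′|≡ = picked-length |R|≡ R↭
        r≤ : r ≤ t ℕ.+ h
        r≤ = subst₂ _≤_ r≡ |R′|≡ (length-filter (T? ∘ below y) R′)
        factor : ∀ a w x d z → a * (w * x) + d * (w * z) ≡ w * (a * x + d * z)
        factor = solve-∀ℚ ℚ-ring
        swap : ∀ a b c → a * (b * c) ≡ b * (a * c)
        swap = solve-∀ℚ ℚ-ring

    ∑-picks-M : ∀ t R → length R ≡ suc t ℕ.+ h → ∑[ p ∈ picks R ] M (proj₂ p) ≡ fromℕ (suc (t ℕ.+ h)) * M R
    ∑-picks-M t R |R|≡ = begin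
      ∑[ p ∈ picks R ] (∑ (proj₂ p) (weight (proj₂ p)) * ratio 1 (length (proj₂ p) C suc k))
        ≡⟨ ∑-cong-local (All.map (λ {p} R↭ → cong (λ l → ∑ (proj₂ p) (weight (proj₂ p)) * ratio 1 (l C suc k)) (picked-length |R|≡ R↭)) (picks-↭ R)) ⟩
      ∑[ p ∈ picks R ] (∑ (proj₂ p) (weight (proj₂ p)) * ratio 1 ((t ℕ.+ h) C suc k))
        ≡⟨ ∑-*ʳ (ratio 1 ((t ℕ.+ h) C suc k)) (picks R) (λ p → ∑ (proj₂ p) (weight (proj₂ p))) ⟩
      ∑[ p ∈ picks R ] ∑ (proj₂ p) (weight (proj₂ p)) * ratio 1 ((t ℕ.+ h) C suc k)
        ≡⟨ cong (_* ratio 1 ((t ℕ.+ h) C suc k)) (∑-picks-weight t R |R|≡) ⟩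
      fromℕ (t ℕ.+ h ∸ k) * ∑ R (weight R) * ratio 1 ((t ℕ.+ h) C suc k)
        ≡⟨ swap (fromℕ (t ℕ.+ h ∸ k)) (∑ R (weight R)) (ratio 1 ((t ℕ.+ h) C suc k)) ⟩
      ∑ R (weight R) * (fromℕ (t ℕ.+ h ∸ k) * ratio 1 ((t ℕ.+ h) C suc k))
        ≡⟨ cong (∑ R (weight R) *_) (deletion-ratio t) ⟩
      ∑ R (weight R) * (fromℕ (suc (t ℕ.+ h)) * ratio 1 (suc (t ℕ.+ h) C suc k))
        ≡⟨ cong (λ l → ∑ R (weight R) * (fromℕ (suc (t ℕ.+ h)) * ratio 1 (l C suc k))) (sym |R|≡) ⟩
      ∑ R (weight R) * (fromℕ (suc (t ℕ.+ h)) * ratio 1 (length R C suc k))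
        ≡⟨ swap′ (∑ R (weight R)) (fromℕ (suc (t ℕ.+ h))) (ratio 1 (length R C suc k)) ⟩
      fromℕ (suc (t ℕ.+ h)) * M R
        ∎
      where
      swap : ∀ a w r → a * w * r ≡ w * (a * r)
      swap = solve-∀ℚ ℚ-ring
      swap′ : ∀ w m r → w * (m * r) ≡ m * (w * r)
      swap′ = solve-∀ℚ ℚ-ring

    ∑-gain : ∀ t R → length R ≡ t ℕ.+ h → Unique R →
      ∑[ σ ∈ perms R ] gain σ ≡ (1ℚ - β ^ℚ t) * (fromℕ (length R !) * M R)
    ∑-gain zero R |R|≡h _ = begin
      ∑[ σ ∈ perms R ] gain σ
        ≡⟨ ∑-cong-local (All.map (λ σ↭R → cong (algValue v k _) (online-empty σ↭R |R|≡h)) (perms-↭ R)) ⟩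
      ∑[ σ ∈ perms R ] 0ℚ
        ≡⟨ ∑-const 0ℚ (perms R) ⟩
      fromℕ (length (perms R)) * 0ℚ
        ≡⟨ vanish (fromℕ (length (perms R))) (fromℕ (length R !) * M R) ⟩
      (1ℚ - 1ℚ) * (fromℕ (length R !) * M R)
        ∎
      where
      vanish : ∀ a b → a * 0ℚ ≡ (1ℚ - 1ℚ) * b
      vanish = solve-∀ℚ ℚ-ring
    ∑-gain (suc t) R@(x₀ ∷ R₀) |R|≡ u = begin
      ∑ (perms R) gain
        ≡⟨ ∑-perms-last x₀ R₀ gain ⟩
      ∑[ p ∈ picks R ] ∑[ σ ∈ perms (proj₂ p) ] gain (σ ++ [ proj₁ p ])
        ≡⟨ ∑-cong-local (All.zipWith (λ { (R↭ , u′) → step R↭ u′ }) (picks-↭ R , unique-picked u)) ⟩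
      ∑[ p ∈ picks R ] ((1ℚ - β ^ℚ t) * (F * M (proj₂ p)) + F * β ^ℚ t * (r * weight R (proj₁ p)))
        ≡⟨ ∑-distrib-+ (picks R) (λ p → (1ℚ - β ^ℚ t) * (F * M (proj₂ p))) (λ p → F * β ^ℚ t * (r * weight R (proj₁ p))) ⟩
      ∑[ p ∈ picks R ] ((1ℚ - β ^ℚ t) * (F * M (proj₂ p))) + ∑[ p ∈ picks R ] (F * β ^ℚ t * (r * weight R (proj₁ p)))
        ≡⟨ cong₂ _+_ (trans (∑-*ˡ (1ℚ - β ^ℚ t) (picks R) (λ p → F * M (proj₂ p)))
                            (cong ((1ℚ - β ^ℚ t) *_) (trans (∑-*ˡ F (picks R) (M ∘ proj₂)) (cong (F *_) (∑-picks-M t R |R|≡)))))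
                     (trans (∑-*ˡ (F * β ^ℚ t) (picks R) (λ p → r * weight R (proj₁ p)))
                            (cong (F * β ^ℚ t *_) (trans (∑-picks R (λ y → r * weight R y)) (∑-*ˡ r R (weight R))))) ⟩
      (1ℚ - β ^ℚ t) * (F * (fromℕ m * M R)) + F * β ^ℚ t * (r * ∑ R (weight R))
        ≡⟨ cong (λ q → (1ℚ - β ^ℚ t) * (F * (fromℕ m * M R)) + F * β ^ℚ t * (q * ∑ R (weight R))) (accept-ratio t) ⟩
      (1ℚ - β ^ℚ t) * (F * (fromℕ m * M R)) + F * β ^ℚ t * (fromℕ m * ρ * ratio 1 (m C suc k) * ∑ R (weight R))
        ≡⟨ cong (λ l → (1ℚ - β ^ℚ t) * (F * (fromℕ m * M R)) + F * β ^ℚ t * (fromℕ m * ρ * ratio 1 (l C suc k) * ∑ R (weight R))) (sym |R|≡) ⟩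
      (1ℚ - β ^ℚ t) * (F * (fromℕ m * M R)) + F * β ^ℚ t * (fromℕ m * ρ * ratio 1 (length R C suc k) * ∑ R (weight R))
        ≡⟨ regroup (β ^ℚ t) F (fromℕ m) ρ (ratio 1 (length R C suc k)) (∑ R (weight R)) ⟩
      (1ℚ - (1ℚ - ρ) * β ^ℚ t) * (fromℕ m * F * M R)
        ≡⟨ cong (λ q → (1ℚ - β ^ℚ suc t) * (q * M R)) (trans (sym (fromℕ-* m ((t ℕ.+ h) !))) (cong (λ l → fromℕ (l !)) (sym |R|≡))) ⟩
      (1ℚ - β ^ℚ suc t) * (fromℕ (length R !) * M R)
        ∎
      where
      m : ℕ
      m = suc (t ℕ.+ h)
      F r : ℚ
      F = fromℕ ((t ℕ.+ h) !)
      r = ratio 1 ((t ℕ.+ h) C k)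
      regroup : ∀ b F m ρ c W → (1ℚ - b) * (F * (m * (W * c))) + F * b * (m * ρ * c * W) ≡ (1ℚ - (1ℚ - ρ) * b) * (m * F * (W * c))
      regroup = solve-∀ℚ ℚ-ring
      step : ∀ {x R′} → R ↭ x ∷ R′ → Unique R′ →
        ∑[ σ ∈ perms R′ ] gain (σ ++ [ x ]) ≡ (1ℚ - β ^ℚ t) * (F * M R′) + F * β ^ℚ t * (r * weight R x)
      step {x} {R′} R↭ u′ = begin
        ∑[ σ ∈ perms R′ ] gain (σ ++ [ x ])
          ≡⟨ ∑-cong-local (All.map (λ {σ} σ↭ → trans (gain-snoc σ x (h≤length t σ↭ |R′|≡))
                                                      (cong (λ a → gain σ + rejects σ * (a * v x)) (acceptProb-↭ x σ↭)))
                                   (perms-↭ R′)) ⟩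
        ∑[ σ ∈ perms R′ ] (gain σ + rejects σ * (fromℕ (rank x R′ C k) * ratio 1 (length R′ C k) * v x))
          ≡⟨ trans (∑-distrib-+ (perms R′) gain (λ σ → rejects σ * a)) (cong (∑ (perms R′) gain +_) (∑-*ʳ a (perms R′) rejects)) ⟩
        ∑ (perms R′) gain + ∑ (perms R′) rejects * (fromℕ (rank x R′ C k) * ratio 1 (length R′ C k) * v x)
          ≡⟨ cong₂ _+_ (∑-gain t R′ |R′|≡ u′) (cong₂ (λ s l → s * (fromℕ (rank x R′ C k) * ratio 1 (l C k) * v x)) (∑-rejects t R′ |R′|≡ u′) |R′|≡) ⟩
        (1ℚ - β ^ℚ t) * (fromℕ (length R′ !) * M R′) + fromℕ (length R′ !) * β ^ℚ t * (fromℕ (rank x R′ C k) * r * v x)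
          ≡⟨ cong₂ (λ l q → (1ℚ - β ^ℚ t) * (fromℕ (l !) * M R′) + fromℕ (l !) * β ^ℚ t * (fromℕ (q C k) * r * v x)) |R′|≡ (rank-kept x R↭ (≺-irrefl x)) ⟩
        (1ℚ - β ^ℚ t) * (F * M R′) + F * β ^ℚ t * (fromℕ (rank x R C k) * r * v x)
          ≡⟨ cong ((1ℚ - β ^ℚ t) * (F * M R′) +_) (cong (F * β ^ℚ t *_) (reorder (fromℕ (rank x R C k)) r (v x))) ⟩
        (1ℚ - β ^ℚ t) * (F * M R′) + F * β ^ℚ t * (r * weight R x)
          ∎
        where
        |R′|≡ : length R′ ≡ t ℕ.+ h
        |R′|≡ = picked-length |R|≡ R↭
        a : ℚ
        a = fromℕ (rank x R′ C k) * ratio 1 (length R′ C k) * v x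
        reorder : ∀ c r w → c * r * w ≡ r * (w * c)
        reorder = solve-∀ℚ ℚ-ring

    -- Orderings of a set R of size t + h whose online part lies below (resp. has its
    -- maximum at) an element of rank r in R.
    belowCount maxCount : ℕ → ℕ → ℕ
    belowCount t r = falling r t ℕ.* h !
    maxCount   t r = t ℕ.* falling r (t ∸ 1) ℕ.* h !

    ∑-beats : ∀ t R y → length R ≡ t ℕ.+ h → ∑[ σ ∈ perms R ] beats y (drop h σ) ≡ fromℕ (belowCount t (rank y R))
    ∑-beats zero R y |R|≡h = begin
      ∑[ σ ∈ perms R ] beats y (drop h σ)
        ≡⟨ ∑-cong-local (All.map (λ σ↭R → cong (beats y) (online-empty σ↭R |R|≡h)) (perms-↭ R)) ⟩
      ∑[ σ ∈ perms R ] 1ℚ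
        ≡⟨ trans (∑-perms-const 1ℚ R) (ℚₚ.*-identityʳ _) ⟩
      fromℕ (length R !)
        ≡⟨ cong (λ l → fromℕ (l !)) |R|≡h ⟩
      fromℕ (h !)
        ≡⟨ cong fromℕ (sym (ℕₚ.*-identityˡ (h !))) ⟩
      fromℕ (1 ℕ.* h !)
        ∎
    ∑-beats (suc t) R@(x₀ ∷ R₀) y |R|≡ = begin
      ∑ (perms R) (beats y ∘ drop h)
        ≡⟨ ∑-perms-last x₀ R₀ (beats y ∘ drop h) ⟩
      ∑[ p ∈ picks R ] ∑[ σ ∈ perms (proj₂ p) ] beats y (drop h (σ ++ [ proj₁ p ]))
        ≡⟨ ∑-cong-local (All.map step (picks-↭ R)) ⟩
      ∑[ p ∈ picks R ] (𝟙 (below y (proj₁ p)) * fromℕ (belowCount t (rank y (proj₂ p))))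
        ≡⟨ ∑-picks-below R y (λ c → fromℕ (belowCount t c)) ⟩
      fromℕ (rank y R) * fromℕ (belowCount t (rank y R ∸ 1))
        ≡⟨ sym (fromℕ-* (rank y R) (belowCount t (rank y R ∸ 1))) ⟩
      fromℕ (rank y R ℕ.* (falling (rank y R ∸ 1) t ℕ.* h !))
        ≡⟨ cong fromℕ (sym (ℕₚ.*-assoc (rank y R) (falling (rank y R ∸ 1) t) (h !))) ⟩
      fromℕ (belowCount (suc t) (rank y R))
        ∎
      where
      step : ∀ {p} → R ↭ proj₁ p ∷ proj₂ p →
        ∑[ σ ∈ perms (proj₂ p) ] beats y (drop h (σ ++ [ proj₁ p ])) ≡ 𝟙 (below y (proj₁ p)) * fromℕ (belowCount t (rank y (proj₂ p)))
      step {x , R′} R↭ = begin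
        ∑[ σ ∈ perms R′ ] beats y (drop h (σ ++ [ x ]))
          ≡⟨ ∑-cong-local (All.map (λ {σ} σ↭ → trans (cong (beats y) (drop-++ˡ h σ [ x ] (h≤length t σ↭ |R′|≡))) (beats-snoc y (drop h σ) x)) (perms-↭ R′)) ⟩
        ∑[ σ ∈ perms R′ ] (beats y (drop h σ) * 𝟙 (below y x))
          ≡⟨ ∑-*ʳ (𝟙 (below y x)) (perms R′) (beats y ∘ drop h) ⟩
        ∑[ σ ∈ perms R′ ] beats y (drop h σ) * 𝟙 (below y x)
          ≡⟨ cong (_* 𝟙 (below y x)) (∑-beats t R′ y |R′|≡) ⟩
        fromℕ (belowCount t (rank y R′)) * 𝟙 (below y x)
          ≡⟨ ℚₚ.*-comm (fromℕ (belowCount t (rank y R′))) (𝟙 (below y x)) ⟩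
        𝟙 (below y x) * fromℕ (belowCount t (rank y R′))
          ∎
        where
        |R′|≡ : length R′ ≡ t ℕ.+ h
        |R′|≡ = picked-length |R|≡ R↭

    ∑-top : ∀ t R u → length R ≡ t ℕ.+ h →
      ∑[ σ ∈ perms R ] top u (drop h σ) ≡ ∑[ y ∈ R ] (u y * fromℕ (maxCount t (rank y R)))
    ∑-top zero R u |R|≡h = begin
      ∑[ σ ∈ perms R ] top u (drop h σ)
        ≡⟨ ∑-cong-local (All.map (λ σ↭R → cong (top u) (online-empty σ↭R |R|≡h)) (perms-↭ R)) ⟩
      ∑[ σ ∈ perms R ] 0ℚ
        ≡⟨ trans (∑-const 0ℚ (perms R)) (ℚₚ.*-zeroʳ (fromℕ (length (perms R)))) ⟩
      0ℚ
        ≡⟨ sym (trans (∑-const 0ℚ R) (ℚₚ.*-zeroʳ (fromℕ (length R)))) ⟩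
      ∑[ y ∈ R ] 0ℚ
        ≡⟨ ∑-cong-≗ R (λ y → sym (ℚₚ.*-zeroʳ (u y))) ⟩
      ∑[ y ∈ R ] (u y * 0ℚ)
        ∎
    ∑-top (suc t) R@(x₀ ∷ R₀) u |R|≡ = begin
      ∑ (perms R) (top u ∘ drop h)
        ≡⟨ ∑-perms-last x₀ R₀ (top u ∘ drop h) ⟩
      ∑[ p ∈ picks R ] ∑[ σ ∈ perms (proj₂ p) ] top u (drop h (σ ++ [ proj₁ p ]))
        ≡⟨ ∑-cong-local (All.map step (picks-↭ R)) ⟩
      ∑[ p ∈ picks R ] (survivors p + own p)
        ≡⟨ ∑-distrib-+ (picks R) survivors own ⟩
      ∑ (picks R) survivors + ∑ (picks R) own
        ≡⟨ cong (_+ ∑ (picks R) own) (∑-picks-rank R g) ⟩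
      ∑ (picks R) shifted + ∑ (picks R) own
        ≡⟨ sym (∑-distrib-+ (picks R) shifted own) ⟩
      ∑[ p ∈ picks R ] (shifted p + own p)
        ≡⟨ ∑-cong-≗ (picks R) (λ p → count (rank (proj₁ p) R) (fromℕ (length (proj₂ p) ∸ rank (proj₁ p) R)) (u (proj₁ p))) ⟩
      ∑[ p ∈ picks R ] (u (proj₁ p) * fromℕ (maxCount (suc t) (rank (proj₁ p) R)))
        ≡⟨ ∑-picks R (λ y → u y * fromℕ (maxCount (suc t) (rank y R))) ⟩
      ∑[ y ∈ R ] (u y * fromℕ (maxCount (suc t) (rank y R)))
        ∎
      where
      g : Bool → Fin N → ℕ → ℚ
      g b y c = 𝟙 b * u y * fromℕ (maxCount t c)
      survivors own shifted : Fin N × List (Fin N) → ℚ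
      survivors p = ∑[ y ∈ proj₂ p ] g (below y (proj₁ p)) y (rank y (proj₂ p))
      own p       = u (proj₁ p) * fromℕ (belowCount t (rank (proj₁ p) R))
      shifted p   = fromℕ (rank (proj₁ p) R) * g true (proj₁ p) (rank (proj₁ p) R ∸ 1)
                    + fromℕ (length (proj₂ p) ∸ rank (proj₁ p) R) * g false (proj₁ p) (rank (proj₁ p) R)
      count : ∀ r d w → fromℕ r * (1ℚ * w * fromℕ (maxCount t (r ∸ 1))) + d * (0ℚ * w * fromℕ (maxCount t r)) + w * fromℕ (belowCount t r)
                        ≡ w * fromℕ (maxCount (suc t) r)
      count r d w = begin
        fromℕ r * (1ℚ * w * fromℕ (maxCount t (r ∸ 1))) + d * (0ℚ * w * fromℕ (maxCount t r)) + w * fromℕ (belowCount t r)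
          ≡⟨ collect (fromℕ r) w (fromℕ (maxCount t (r ∸ 1))) d (fromℕ (maxCount t r)) (fromℕ (belowCount t r)) ⟩
        w * (fromℕ r * fromℕ (maxCount t (r ∸ 1)) + fromℕ (belowCount t r))
          ≡⟨ cong (w *_) (sym (trans (fromℕ-+ (r ℕ.* maxCount t (r ∸ 1)) (belowCount t r)) (cong (_+ fromℕ (belowCount t r)) (fromℕ-* r (maxCount t (r ∸ 1)))))) ⟩
        w * fromℕ (r ℕ.* maxCount t (r ∸ 1) ℕ.+ belowCount t r)
          ≡⟨ cong (λ n → w * fromℕ n) (arrange r t (falling (r ∸ 1) (t ∸ 1)) (falling r t) (h !)) ⟩
        w * fromℕ ((r ℕ.* (t ℕ.* falling (r ∸ 1) (t ∸ 1)) ℕ.+ falling r t) ℕ.* h !)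
          ≡⟨ cong (λ n → w * fromℕ (n ℕ.* h !)) (r*[t*falling[r∸1][t∸1]]+falling≡[1+t]*falling r t) ⟩
        w * fromℕ (maxCount (suc t) r)
          ∎
        where
        collect : ∀ a w x d y z → a * (1ℚ * w * x) + d * (0ℚ * w * y) + w * z ≡ w * (a * x + z)
        collect = solve-∀ℚ ℚ-ring
        arrange : ∀ r t f g H → r ℕ.* (t ℕ.* f ℕ.* H) ℕ.+ g ℕ.* H ≡ (r ℕ.* (t ℕ.* f) ℕ.+ g) ℕ.* H
        arrange = solve-∀ℕ
      step : ∀ {p} → R ↭ proj₁ p ∷ proj₂ p →
        ∑[ σ ∈ perms (proj₂ p) ] top u (drop h (σ ++ [ proj₁ p ])) ≡ survivors p + own p
      step {x , R′} R↭ = begin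
        ∑[ σ ∈ perms R′ ] top u (drop h (σ ++ [ x ]))
          ≡⟨ ∑-cong-local (All.map (λ {σ} σ↭ → trans (cong (top u) (drop-++ˡ h σ [ x ] (h≤length t σ↭ |R′|≡))) (top-snoc u (drop h σ) x)) (perms-↭ R′)) ⟩
        ∑[ σ ∈ perms R′ ] (top (above x u) (drop h σ) + u x * beats x (drop h σ))
          ≡⟨ trans (∑-distrib-+ (perms R′) (top (above x u) ∘ drop h) (λ σ → u x * beats x (drop h σ)))
                   (cong (∑ (perms R′) (top (above x u) ∘ drop h) +_) (∑-*ˡ (u x) (perms R′) (beats x ∘ drop h))) ⟩
        ∑ (perms R′) (top (above x u) ∘ drop h) + u x * ∑ (perms R′) (beats x ∘ drop h)
          ≡⟨ cong₂ _+_ (∑-top t R′ (above x u) |R′|≡) (cong (u x *_) (∑-beats t R′ x |R′|≡)) ⟩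
        ∑[ y ∈ R′ ] (above x u y * fromℕ (maxCount t (rank y R′))) + u x * fromℕ (belowCount t (rank x R′))
          ≡⟨ cong (λ r → ∑[ y ∈ R′ ] (above x u y * fromℕ (maxCount t (rank y R′))) + u x * fromℕ (belowCount t r)) (rank-kept x R↭ (≺-irrefl x)) ⟩
        ∑[ y ∈ R′ ] g (below y x) y (rank y R′) + u x * fromℕ (belowCount t (rank x R))
          ∎
        where
        |R′|≡ : length R′ ≡ t ℕ.+ h
        |R′|≡ = picked-length |R|≡ R↭

    K-ratio : fromℕ (suc k ! ℕ.* h !) ≡ fromℕ ((suc k ℕ.+ h) !) * ratio 1 ((suc k ℕ.+ h) C suc k)
    K-ratio = trans (sym (ℚₚ.*-identityʳ _)) (ratio1-cross {suc k ! ℕ.* h !} {(suc k ℕ.+ h) !} {1} {(suc k ℕ.+ h) C suc k}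
      (trans (ℕₚ.*-comm (suc k ! ℕ.* h !) _) (trans ([k+h]Ck*[k!*h!]≡[k+h]! (suc k) h) (sym (ℕₚ.*-identityʳ _)))))
      where
      instance
        [1+k+h]C[1+k]≢0 : ℕ.NonZero ((suc k ℕ.+ h) C suc k)
        [1+k+h]C[1+k]≢0 = ℕ.>-nonZero (nCk>0 (ℕₚ.m≤m+n (suc k) h))

    ∑-optValue : (∀ i → 0ℚ ℚ.≤ v i) → ∀ R → Unique R → length R ≡ suc k ℕ.+ h →
      ∑[ σ ∈ perms R ] optValue v (drop h σ) ≡ fromℕ (length R !) * M R
    ∑-optValue nonneg R u |R|≡ = begin
      ∑[ σ ∈ perms R ] optValue v (drop h σ)
        ≡⟨ ∑-cong-local (All.map (λ σ↭R → optValue≡top nonneg (Unique.drop⁺ h (Unique-resp-↭ (↭⇒↭ₛ (↭-sym σ↭R)) u))) (perms-↭ R)) ⟩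
      ∑[ σ ∈ perms R ] top v (drop h σ)
        ≡⟨ ∑-top (suc k) R v |R|≡ ⟩
      ∑[ y ∈ R ] (v y * fromℕ (maxCount (suc k) (rank y R)))
        ≡⟨ ∑-cong-≗ R (λ y → reorder (rank y R)) ⟩
      ∑[ y ∈ R ] (fromℕ (suc k ! ℕ.* h !) * weight R y)
        ≡⟨ ∑-*ˡ (fromℕ (suc k ! ℕ.* h !)) R (weight R) ⟩
      fromℕ (suc k ! ℕ.* h !) * ∑ R (weight R)
        ≡⟨ cong (_* ∑ R (weight R)) K-ratio ⟩
      fromℕ ((suc k ℕ.+ h) !) * ratio 1 ((suc k ℕ.+ h) C suc k) * ∑ R (weight R)
        ≡⟨ cong (λ l → fromℕ (l !) * ratio 1 (l C suc k) * ∑ R (weight R)) (sym |R|≡) ⟩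
      fromℕ (length R !) * ratio 1 (length R C suc k) * ∑ R (weight R)
        ≡⟨ swap (fromℕ (length R !)) (ratio 1 (length R C suc k)) (∑ R (weight R)) ⟩
      fromℕ (length R !) * M R
        ∎
      where
      swap : ∀ a b c → a * b * c ≡ a * (c * b)
      swap = solve-∀ℚ ℚ-ring
      reorder : ∀ {y} r → v y * fromℕ (maxCount (suc k) r) ≡ fromℕ (suc k ! ℕ.* h !) * (v y * fromℕ (r C k))
      reorder {y} r = begin
        v y * fromℕ (suc k ℕ.* falling r k ℕ.* h !)
          ≡⟨ cong (λ f → v y * fromℕ (suc k ℕ.* f ℕ.* h !)) (falling≡k!*nCk r k) ⟩
        v y * fromℕ (suc k ℕ.* (k ! ℕ.* (r C k)) ℕ.* h !)
          ≡⟨ cong (λ n → v y * fromℕ n) (arrange (suc k) (k !) (r C k) (h !)) ⟩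
        v y * fromℕ (suc k ! ℕ.* h ! ℕ.* (r C k))
          ≡⟨ cong (v y *_) (fromℕ-* (suc k ! ℕ.* h !) (r C k)) ⟩
        v y * (fromℕ (suc k ! ℕ.* h !) * fromℕ (r C k))
          ≡⟨ swap′ (v y) (fromℕ (suc k ! ℕ.* h !)) (fromℕ (r C k)) ⟩
        fromℕ (suc k ! ℕ.* h !) * (v y * fromℕ (r C k))
          ∎
        where
        arrange : ∀ n f c H → n ℕ.* (f ℕ.* c) ℕ.* H ≡ n ℕ.* f ℕ.* H ℕ.* c
        arrange = solve-∀ℕ
        swap′ : ∀ a b c → a * (b * c) ≡ b * (a * c)
        swap′ = solve-∀ℚ ℚ-ring

    E[ALG]≡[1-β^n]*E[OPT] : (∀ i → 0ℚ ℚ.≤ v i) → ∀ R → Unique R → length R ≡ suc k ℕ.+ h →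
      (1ℚ - β ^ℚ suc k) * average (map (λ σ → optValue v (drop h σ)) (perms R)) ≡ average (map gain (perms R))
    E[ALG]≡[1-β^n]*E[OPT] nonneg R u |R|≡ = begin
      (1ℚ - β ^ℚ suc k) * average (map (λ σ → optValue v (drop h σ)) (perms R))
        ≡⟨ cong ((1ℚ - β ^ℚ suc k) *_) (average-map (λ σ → optValue v (drop h σ)) (perms R)) ⟩
      (1ℚ - β ^ℚ suc k) * (∑[ σ ∈ perms R ] optValue v (drop h σ) * ratio 1 (length (perms R)))
        ≡⟨ cong (λ s → (1ℚ - β ^ℚ suc k) * (s * ratio 1 (length (perms R)))) (∑-optValue nonneg R u |R|≡) ⟩
      (1ℚ - β ^ℚ suc k) * (fromℕ (length R !) * M R * ratio 1 (length (perms R)))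
        ≡⟨ sym (ℚₚ.*-assoc (1ℚ - β ^ℚ suc k) _ _) ⟩
      (1ℚ - β ^ℚ suc k) * (fromℕ (length R !) * M R) * ratio 1 (length (perms R))
        ≡⟨ cong (_* ratio 1 (length (perms R))) (sym (∑-gain (suc k) R |R|≡ u)) ⟩
      ∑ (perms R) gain * ratio 1 (length (perms R))
        ≡⟨ sym (average-map gain (perms R)) ⟩
      average (map gain (perms R))
        ∎

open import Data.Nat using (ℕ; _+_; _≤_)
open import Data.Fin using (Fin)
open import Data.Rational using (ℚ; 0ℚ) renaming (_≤_ to _≤ℚ_; _*_ to _*ℚ_)
open import Data.Rational.Properties using (≤-reflexive)
open import Data.List using (allFin)
open import Data.List.Properties using (length-tabulate)
open import Data.List.Relation.Unary.Unique.Propositional.Properties using (allFin⁺)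

theorem6 : (n h : ℕ) → 1 ≤ n → n ≤ h →
    (v : Fin (n + h) → ℚ) → (∀ i → 0ℚ ≤ℚ v i) →
    ratioBound n *ℚ expectedOPT n h v ≤ℚ expectedALG n h v
theorem6 (suc k) h _ n≤h v nonneg =
  ≤-reflexive (E[ALG]≡[1-β^n]*E[OPT] nonneg (allFin (suc k + h)) (allFin⁺ (suc k + h)) (length-tabulate id))
  where
  open Candidates v
  open Analysis k h n≤h
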